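{- Let $v\equiv 3\pmod 4$ with $v>3$. Then every $\mathrm{STS}(v)$ with a zero-sum $3$-flow can be embedded into an $\mathrm{STS}(2v+1)$ with a zero-sum $3$-flow.
   Context: A Steiner triple system $\mathrm{STS}(v)$ is a pair $(X,\mathcal B)$ where $X$ is a set of $v$ points and $\mathcal B$ is a set of $3$-subsets of $X$ (blocks) such that every $2$-subset of $X$ lies in exactly one block. For a positive integer $n$, a zero-sum $n$-flow of such a system is a map $f:\mathcal B\to\{\pm1,\dots,\pm(n-1)\}$ such that for every point $x$, $\sum_{B\ni x} f(B)=0$. An $\mathrm{STS}(v)$ $(X,\mathcal B)$ is embedded in an $\mathrm{STS}(w)$ $(Y,\mathcal C)$ if $X\subseteq Y$ and $\mathcal B\subseteq\mathcal C$. -}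

module Defs where

open import Data.Nat using (ℕ; zero; suc)
open import Data.Fin using (Fin) renaming (_<_ to _<ᶠ_)
open import Data.Fin.Properties using (_≟_)
open import Data.Product using (_×_; _,_; Σ; ∃)
open import Data.List using (List; length; lookup; filter; map; foldr; allFin)
open import Data.List.Relation.Unary.Unique.Propositional using (Unique)
open import Data.List.Relation.Unary.All using (All)
open import Data.List.Membership.Propositional using (_∈_)
open import Data.Integer using (ℤ; 0ℤ; +_; ∣_∣) renaming (_+_ to _+ℤ_)
open import Relation.Binary.PropositionalEquality using (_≡_; _≢_)
open import Relation.Nullary using (¬_; Dec; yes; no)
open import Relation.Nullary.Decidable using (_⊎-dec_)
open import Function using (Injective)

Triple : ℕ → Set
Triple v = Fin v × Fin v × Fin v

_∈ᵇ_ : ∀ {v} → Fin v → Triple v → Set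
x ∈ᵇ (a , b , c) = (x ≡ a) Data.Sum.⊎ (x ≡ b) Data.Sum.⊎ (x ≡ c)
  where import Data.Sum

_∈ᵇ?_ : ∀ {v} (x : Fin v) (t : Triple v) → Dec (x ∈ᵇ t)
x ∈ᵇ? (a , b , c) = (x ≟ a) ⊎-dec ((x ≟ b) ⊎-dec (x ≟ c))

-- A 3-subset is represented by its increasing enumeration a < b < c.
Sorted : ∀ {v} → Triple v → Set
Sorted (a , b , c) = (a <ᶠ b) × (b <ᶠ c)

blocksAt : ∀ {v} (B : List (Triple v)) → Fin v → List (Fin (length B))
blocksAt B x = filter (λ i → x ∈ᵇ? lookup B i) (allFin (length B))

blocksAt₂ : ∀ {v} (B : List (Triple v)) → Fin v → Fin v → List (Fin (length B))
blocksAt₂ B x y = filter (λ i → y ∈ᵇ? lookup B i) (blocksAt B x)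

record IsSTS (v : ℕ) (B : List (Triple v)) : Set where
  field
    sorted  : All Sorted B
    unique  : Unique B
    steiner : ∀ (x y : Fin v) → x ≢ y → length (blocksAt₂ B x y) ≡ 1

IsZeroSumFlow : ∀ {v} (n : ℕ) (B : List (Triple v)) → (Fin (length B) → ℤ) → Set
IsZeroSumFlow {v} n B f =
  (∀ i → ¬ (f i ≡ 0ℤ)) ×
  (∀ i → ∣ f i ∣ Data.Nat.< n) ×
  (∀ (x : Fin v) → foldr _+ℤ_ 0ℤ (map f (blocksAt B x)) ≡ 0ℤ)
  where import Data.Nat

HasZeroSumFlow : ∀ {v} (n : ℕ) (B : List (Triple v)) → Set
HasZeroSumFlow n B = Σ (Fin (length B) → ℤ) (IsZeroSumFlow n B)

mapTriple : ∀ {v w} → (Fin v → Fin w) → Triple v → Triple w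
mapTriple ι (a , b , c) = (ι a , ι b , ι c)

-- (Fin v, B) embeds in (Fin w, C): an injection of the points under which
-- every block of B is (as a 3-set) a block of C.
-- Up to relabelling points this is exactly X ⊆ Y and B ⊆ C.
EmbedsIn : ∀ {v w} → List (Triple v) → List (Triple w) → Set
EmbedsIn {v} {w} B C =
  Σ (Fin v → Fin w) λ ι → Injective _≡_ _≡_ ι ×
    All (λ t → ∃ λ t′ → t′ ∈ C × (∀ z → z ∈ᵇ mapTriple ι t → z ∈ᵇ t′)) B

module Submission where

-- Add n + 1 new points n, …, 2n to an STS(n).  If the complete graph on the new points is split into
-- n perfect matchings indexed by the old points, the old blocks together with {x, n + y, n + z} for
-- every edge yz of the x-th matching form an STS(2n + 1).  A zero-sum flow of the old system extends
-- to it once the edges carry weights such that, at every new point, the weights of its n edges sum to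
-- zero and, at every old point x, the weights of the x-th matching sum to zero.
--
-- For n = 4i + 7 = K + N with N = 2i + 3 and K = N + 1, such a weighting with values in {±1, ±2}
-- exists.  Split the new points into two halves of size K.  The K cyclic matchings a ↦ a + x between
-- the halves get weight sign(a) · ρ(a + x), where ρ repeats every entry of a zero-sum sequence twice,
-- so that Σ ρ = Σ sign · ρ = 0, and Σ sign = 0 as K is even.  The round-robin factorization of the
-- complete graph on N + 1 points, placed on both halves, gets weights β(t) and −β(t) on the two
-- halves for a zero-sum sequence β.

open import Defs
open import Level using (Level; 0ℓ)
open import Algebra.Bundles using (Monoid)
open import Data.Bool using (if_then_else_)
open import Data.Empty using (⊥-elim)
open import Data.Fin using (Fin; zero; suc; toℕ; fromℕ<; inject≤)
open import Data.Fin.Properties using (toℕ-fromℕ<; toℕ-injective; toℕ<n; toℕ-inject≤)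
open import Data.Integer using (ℤ; 0ℤ; 1ℤ; -1ℤ; -_; ∣_∣) renaming (_+_ to _+ℤ_; _*_ to _*ℤ_)
import Data.Integer.Properties as ℤP
open import Data.List
  using (List; []; _∷_; length; lookup; filter; map; foldr; tabulate; allFin; _++_; concat; applyUpTo)
open import Data.List.Properties using (map-tabulate; map-++)
open import Data.List.Membership.Propositional using (_∈_)
open import Data.List.Membership.Propositional.Properties using (∈-map⁺; ∈-++⁺ˡ)
open import Data.List.Relation.Unary.All as All using (All; []; _∷_)
open import Data.List.Relation.Unary.All.Properties using (++⁺; concat⁺; applyUpTo⁺₂)
open import Data.List.Relation.Unary.AllPairs using ([]; _∷_)
open import Data.List.Relation.Unary.Any using (here; there)
open import Data.List.Relation.Unary.Unique.Propositional using (Unique)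
open import Data.Nat
  using (ℕ; zero; suc; _+_; _*_; _∸_; _%_; _/_; _<_; _≤_; s≤s; s≤s⁻¹; z<s; s<s; _<?_; _≤?_; NonZero)
open import Data.Nat.DivMod
  using (m%n%n≡m%n; %-distribˡ-+; %-distribˡ-*; [m+kn]%n≡m%n; [m+n]%n≡m%n; m<n⇒m%n≡m; m%n<n;
         m≡m%n+[m/n]*n)
open import Data.Nat.Properties
open import Data.Nat.Tactic.RingSolver using (solve-∀)
open import Data.Product using (Σ; _×_; _,_; proj₁; proj₂)
open import Data.Sum using (_⊎_; inj₁; inj₂; [_,_]′)
open import Function using (_∘_; id; Injective)
open import Relation.Binary.Bundles using (Setoid)
open import Relation.Binary.PropositionalEquality
open import Relation.Binary.Structures using (IsEquivalence)
open import Relation.Nullary using (¬_; Dec; yes; no; does)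
open import Relation.Nullary.Decidable using (toSum)
open import Relation.Unary using (Pred; Decidable)

-- Finite sums

module MonoidSums {c ℓ} (M : Monoid c ℓ) where

  open Monoid M renaming (refl to ≈-refl; sym to ≈-sym; trans to ≈-trans)

  private variable
    p q : Level
    P : Set p
    Q : Set q
  open import Algebra.Definitions.RawMonoid rawMonoid public using (sum)

  when : Dec P → Carrier → Carrier
  when d z = if does d then z else ε

  when-yes : ∀ (d : Dec P) z → P → when d z ≈ z
  when-yes (yes _) z _ = ≈-refl
  when-yes (no ¬p) z p = ⊥-elim (¬p p)

  when-no : ∀ (d : Dec P) z → ¬ P → when d z ≈ ε
  when-no (yes p) z ¬p = ⊥-elim (¬p p)
  when-no (no _) z _ = ≈-refl

  when-⇔ : ∀ (d : Dec P) (e : Dec Q) z → (P → Q) → (Q → P) → when d z ≈ when e z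
  when-⇔ (yes p) e z to from = ≈-sym (when-yes e z (to p))
  when-⇔ (no ¬p) e z to from = ≈-sym (when-no e z (¬p ∘ from))

  when-when-no : ∀ (d : Dec P) (e : Dec Q) z → (P → ¬ Q) → when d (when e z) ≈ ε
  when-when-no (yes p) e z ¬pq = when-no e z (¬pq p)
  when-when-no (no _) e z _ = ≈-refl

  when-when-comm : ∀ (d : Dec P) (e : Dec Q) z → when d (when e z) ≈ when e (when d z)
  when-when-comm (yes _) (yes _) z = ≈-refl
  when-when-comm (yes _) (no _) z = ≈-refl
  when-when-comm (no _) (yes _) z = ≈-refl
  when-when-comm (no _) (no _) z = ≈-refl

  sum< : ℕ → (ℕ → Carrier) → Carrier
  sum< zero g = ε
  sum< (suc m) g = g 0 ∙ sum< m (g ∘ suc)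

  sum<-cong : ∀ m {g h} → (∀ i → i < m → g i ≈ h i) → sum< m g ≈ sum< m h
  sum<-cong zero eq = ≈-refl
  sum<-cong (suc m) eq = ∙-cong (eq 0 z<s) (sum<-cong m (λ i i<m → eq (suc i) (s<s i<m)))

  sum<-zero : ∀ m {g} → (∀ i → i < m → g i ≈ ε) → sum< m g ≈ ε
  sum<-zero zero eq = ≈-refl
  sum<-zero (suc m) eq =
    ≈-trans (∙-cong (eq 0 z<s) (sum<-zero m (λ i i<m → eq (suc i) (s<s i<m)))) (identityˡ ε)

  sum<-single : ∀ m {g} j → j < m → (∀ i → i < m → i ≢ j → g i ≈ ε) → sum< m g ≈ g j
  sum<-single (suc m) {g} zero _ eq =
    ≈-trans (∙-cong ≈-refl (sum<-zero m (λ i i<m → eq (suc i) (s<s i<m) λ ()))) (identityʳ (g 0))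
  sum<-single (suc m) (suc j) (s≤s j<m) eq =
    ≈-trans (∙-cong (eq 0 z<s λ ()) (sum<-single m j j<m λ i i<m i≢j →
                                         eq (suc i) (s<s i<m) (i≢j ∘ suc-injective)))
            (identityˡ _)

  sum<-+ : ∀ m k g → sum< (m + k) g ≈ sum< m g ∙ sum< k (λ i → g (m + i))
  sum<-+ zero k g = ≈-sym (identityˡ _)
  sum<-+ (suc m) k g = ≈-trans (∙-cong ≈-refl (sum<-+ m k (g ∘ suc))) (≈-sym (assoc (g 0) _ _))

  foldr-map-filter : ∀ {a p} {A : Set a} {P : Pred A p} (P? : Decidable P) (f : A → Carrier) xs →
    foldr _∙_ ε (map f (filter P? xs)) ≈ foldr _∙_ ε (map (λ x → when (P? x) (f x)) xs)
  foldr-map-filter P? f [] = ≈-refl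
  foldr-map-filter P? f (x ∷ xs) with P? x
  ... | yes _ = ∙-cong ≈-refl (foldr-map-filter P? f xs)
  ... | no _ = ≈-trans (foldr-map-filter P? f xs) (≈-sym (identityˡ _))

  foldr-map-allFin : ∀ {m} (h : Fin m → Carrier) → foldr _∙_ ε (map h (allFin m)) ≈ sum h
  foldr-map-allFin h = ≈-trans (reflexive (cong (foldr _∙_ ε) (map-tabulate id h))) (foldr-tabulate h)
    where
    foldr-tabulate : ∀ {m} (h : Fin m → Carrier) → foldr _∙_ ε (tabulate h) ≈ sum h
    foldr-tabulate {zero} h = ≈-refl
    foldr-tabulate {suc m} h = ∙-cong ≈-refl (foldr-tabulate (h ∘ suc))

module ℕΣ = MonoidSums +-0-monoid
open MonoidSums ℤP.+-0-monoid

sum<-distrib : ∀ m g h → sum< m (λ i → g i +ℤ h i) ≡ sum< m g +ℤ sum< m h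
sum<-distrib zero g h = refl
sum<-distrib (suc m) g h = begin
  (g 0 +ℤ h 0) +ℤ sum< m (λ i → g (suc i) +ℤ h (suc i))
    ≡⟨ cong ((g 0 +ℤ h 0) +ℤ_) (sum<-distrib m (g ∘ suc) (h ∘ suc)) ⟩
  (g 0 +ℤ h 0) +ℤ (sum< m (g ∘ suc) +ℤ sum< m (h ∘ suc))
    ≡⟨ interchange (g 0) (h 0) _ _ ⟩
  (g 0 +ℤ sum< m (g ∘ suc)) +ℤ (h 0 +ℤ sum< m (h ∘ suc))
    ∎
  where
  open ≡-Reasoning
  open import Algebra.Properties.CommutativeSemigroup ℤP.+-commutativeSemigroup using (interchange)

sum<-*ˡ : ∀ m c g → sum< m (λ i → c *ℤ g i) ≡ c *ℤ sum< m g
sum<-*ˡ zero c g = sym (ℤP.*-zeroʳ c)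
sum<-*ˡ (suc m) c g =
  trans (cong (c *ℤ g 0 +ℤ_) (sum<-*ˡ m c (g ∘ suc))) (sym (ℤP.*-distribˡ-+ c (g 0) _))

sum<-neg : ∀ m g → sum< m (λ i → - g i) ≡ - sum< m g
sum<-neg zero g = refl
sum<-neg (suc m) g = trans (cong (- g 0 +ℤ_) (sum<-neg m (g ∘ suc))) (sym (ℤP.neg-distrib-+ (g 0) _))

when-+-when-neg : ∀ {p q} {P : Set p} {Q : Set q} (d : Dec P) (e : Dec Q) z → (P → Q) → (Q → P) →
  when d z +ℤ when e (- z) ≡ 0ℤ
when-+-when-neg (yes _) (yes _) z _ _ = ℤP.+-inverseʳ z
when-+-when-neg (yes p) (no ¬q) z to _ = ⊥-elim (¬q (to p))
when-+-when-neg (no ¬p) (yes q) z _ from = ⊥-elim (¬p (from q))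
when-+-when-neg (no _) (no _) z _ _ = refl

sum<-rotate : ∀ M .{{_ : NonZero M}} {c} → c < M → ∀ g → sum< M (λ s → g ((c + s) % M)) ≡ sum< M g
sum<-rotate M {c} c<M g = begin
  sum< M (g ∘ rot)                                    ≡⟨ cong (λ m → sum< m (g ∘ rot)) (m∸n+n≡m c≤M) ⟨
  sum< (d + c) (g ∘ rot)                              ≡⟨ sum<-+ d c (g ∘ rot) ⟩
  sum< d (g ∘ rot) +ℤ sum< c (λ j → g (rot (d + j)))  ≡⟨ cong₂ _+ℤ_ (sum<-cong d noWrap) (sum<-cong c wrap) ⟩
  sum< d (λ s → g (c + s)) +ℤ sum< c g                ≡⟨ ℤP.+-comm (sum< d (λ s → g (c + s))) (sum< c g) ⟩
  sum< c g +ℤ sum< d (λ s → g (c + s))                ≡⟨ sum<-+ c d g ⟨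
  sum< (c + d) g                                      ≡⟨ cong (λ m → sum< m g) (m+[n∸m]≡n c≤M) ⟩
  sum< M g                                            ∎
  where
  open ≡-Reasoning
  c≤M = <⇒≤ c<M
  d = M ∸ c
  rot = λ s → (c + s) % M
  noWrap : ∀ s → s < d → g (rot s) ≡ g (c + s)
  noWrap s s<d = cong g (m<n⇒m%n≡m (subst (c + s <_) (m+[n∸m]≡n c≤M) (+-monoʳ-< c s<d)))
  wrap : ∀ j → j < c → g (rot (d + j)) ≡ g j
  wrap j j<c = cong g (begin
    (c + (d + j)) % M  ≡⟨ cong (_% M) (trans (sym (+-assoc c d j)) (cong (_+ j) (m+[n∸m]≡n c≤M))) ⟩
    (M + j) % M        ≡⟨ cong (_% M) (+-comm M j) ⟩
    (j + M) % M        ≡⟨ [m+n]%n≡m%n j M ⟩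
    j % M              ≡⟨ m<n⇒m%n≡m (<-trans j<c c<M) ⟩
    j                  ∎)

-- Weighted lists of blocks

length-as-foldr : ∀ {a} {A : Set a} (xs : List A) → length xs ≡ foldr _+_ 0 (map (λ _ → 1) xs)
length-as-foldr [] = refl
length-as-foldr (x ∷ xs) = cong suc (length-as-foldr xs)

WeightedBlocks : ℕ → Set
WeightedBlocks w = List (Triple w × ℤ)

weights : ∀ {w} (L : WeightedBlocks w) → Fin (length (map proj₁ L)) → ℤ
weights (e ∷ L) zero = proj₂ e
weights (e ∷ L) (suc i) = weights L i

flowAt : ∀ {w} → Fin w → WeightedBlocks w → ℤ
flowAt p [] = 0ℤ
flowAt p ((t , z) ∷ L) = when (p ∈ᵇ? t) z +ℤ flowAt p L

pairCount : ∀ {w} → Fin w → Fin w → List (Triple w) → ℕ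
pairCount p q [] = 0
pairCount p q (t ∷ C) = ℕΣ.when (p ∈ᵇ? t) (ℕΣ.when (q ∈ᵇ? t) 1) + pairCount p q C

foldr-blocksAt : ∀ {w} (C : List (Triple w)) (f : Fin (length C) → ℤ) p →
  foldr _+ℤ_ 0ℤ (map f (blocksAt C p)) ≡ sum (λ i → when (p ∈ᵇ? lookup C i) (f i))
foldr-blocksAt C f p =
  trans (foldr-map-filter (λ i → p ∈ᵇ? lookup C i) f (allFin _))
        (foldr-map-allFin (λ i → when (p ∈ᵇ? lookup C i) (f i)))

flowAt-as-sum : ∀ {w} (L : WeightedBlocks w) p →
  flowAt p L ≡ sum (λ i → when (p ∈ᵇ? lookup (map proj₁ L) i) (weights L i))
flowAt-as-sum [] p = refl
flowAt-as-sum ((t , z) ∷ L) p = cong (when (p ∈ᵇ? t) z +ℤ_) (flowAt-as-sum L p)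

length-blocksAt₂ : ∀ {w} (C : List (Triple w)) p q → length (blocksAt₂ C p q) ≡ pairCount p q C
length-blocksAt₂ C p q = begin
  length (filter Q? (filter P? Is))
    ≡⟨ length-as-foldr (filter Q? (filter P? Is)) ⟩
  foldr _+_ 0 (map (λ _ → 1) (filter Q? (filter P? Is)))
    ≡⟨ ℕΣ.foldr-map-filter Q? (λ _ → 1) (filter P? Is) ⟩
  foldr _+_ 0 (map (λ i → ℕΣ.when (Q? i) 1) (filter P? Is))
    ≡⟨ ℕΣ.foldr-map-filter P? (λ i → ℕΣ.when (Q? i) 1) Is ⟩
  foldr _+_ 0 (map h Is)
    ≡⟨ ℕΣ.foldr-map-allFin h ⟩
  ℕΣ.sum h
    ≡⟨ sum-counts C ⟩
  pairCount p q C
    ∎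
  where
  open ≡-Reasoning
  Is = allFin (length C)
  P? = λ i → p ∈ᵇ? lookup C i
  Q? = λ i → q ∈ᵇ? lookup C i
  h = λ i → ℕΣ.when (P? i) (ℕΣ.when (Q? i) 1)
  sum-counts : ∀ C →
    ℕΣ.sum (λ i → ℕΣ.when (p ∈ᵇ? lookup C i) (ℕΣ.when (q ∈ᵇ? lookup C i) 1)) ≡ pairCount p q C
  sum-counts [] = refl
  sum-counts (t ∷ C) = cong (ℕΣ.when (p ∈ᵇ? t) (ℕΣ.when (q ∈ᵇ? t) 1) +_) (sum-counts C)

flowAt-++ : ∀ {w} p (L M : WeightedBlocks w) → flowAt p (L ++ M) ≡ flowAt p L +ℤ flowAt p M
flowAt-++ p [] M = sym (ℤP.+-identityˡ _)
flowAt-++ p ((t , z) ∷ L) M =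
  trans (cong (when (p ∈ᵇ? t) z +ℤ_) (flowAt-++ p L M))
        (sym (ℤP.+-assoc (when (p ∈ᵇ? t) z) (flowAt p L) _))

pairCount-++ : ∀ {w} (p q : Fin w) C D → pairCount p q (C ++ D) ≡ pairCount p q C + pairCount p q D
pairCount-++ p q [] D = refl
pairCount-++ p q (t ∷ C) D =
  trans (cong (c +_) (pairCount-++ p q C D)) (sym (+-assoc c (pairCount p q C) _))
  where c = ℕΣ.when (p ∈ᵇ? t) (ℕΣ.when (q ∈ᵇ? t) 1)

flowAt-concat : ∀ {w} p m (g : ℕ → WeightedBlocks w) →
  flowAt p (concat (applyUpTo g m)) ≡ sum< m (λ i → flowAt p (g i))
flowAt-concat p zero g = refl
flowAt-concat p (suc m) g =
  trans (flowAt-++ p (g 0) _) (cong (flowAt p (g 0) +ℤ_) (flowAt-concat p m (g ∘ suc)))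

pairCount-concat : ∀ {w} (p q : Fin w) m (g : ℕ → WeightedBlocks w) →
  pairCount p q (map proj₁ (concat (applyUpTo g m))) ≡ ℕΣ.sum< m (λ i → pairCount p q (map proj₁ (g i)))
pairCount-concat p q zero g = refl
pairCount-concat p q (suc m) g = begin
  pairCount p q (map proj₁ (g 0 ++ rest))
    ≡⟨ cong (pairCount p q) (map-++ proj₁ (g 0) rest) ⟩
  pairCount p q (map proj₁ (g 0) ++ map proj₁ rest)
    ≡⟨ pairCount-++ p q (map proj₁ (g 0)) _ ⟩
  pairCount p q (map proj₁ (g 0)) + pairCount p q (map proj₁ rest)
    ≡⟨ cong (pairCount p q (map proj₁ (g 0)) +_) (pairCount-concat p q m (g ∘ suc)) ⟩
  ℕΣ.sum< (suc m) (λ i → pairCount p q (map proj₁ (g i)))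
    ∎
  where
  open ≡-Reasoning
  rest = concat (applyUpTo (g ∘ suc) m)

module _ {v w} {ι : Fin v → Fin w} where

  ∈ᵇ-mapTriple⁺ : ∀ {a} t → a ∈ᵇ t → ι a ∈ᵇ mapTriple ι t
  ∈ᵇ-mapTriple⁺ t (inj₁ eq) = inj₁ (cong ι eq)
  ∈ᵇ-mapTriple⁺ t (inj₂ (inj₁ eq)) = inj₂ (inj₁ (cong ι eq))
  ∈ᵇ-mapTriple⁺ t (inj₂ (inj₂ eq)) = inj₂ (inj₂ (cong ι eq))

  ∈ᵇ-mapTriple⁻ : Injective _≡_ _≡_ ι → ∀ {a} t → ι a ∈ᵇ mapTriple ι t → a ∈ᵇ t
  ∈ᵇ-mapTriple⁻ ι-inj t (inj₁ eq) = inj₁ (ι-inj eq)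
  ∈ᵇ-mapTriple⁻ ι-inj t (inj₂ (inj₁ eq)) = inj₂ (inj₁ (ι-inj eq))
  ∈ᵇ-mapTriple⁻ ι-inj t (inj₂ (inj₂ eq)) = inj₂ (inj₂ (ι-inj eq))

  pairCount-mapTriple : Injective _≡_ _≡_ ι → ∀ a b C →
    pairCount (ι a) (ι b) (map (mapTriple ι) C) ≡ pairCount a b C
  pairCount-mapTriple ι-inj a b [] = refl
  pairCount-mapTriple ι-inj a b (t ∷ C) = cong₂ _+_ (begin
    ℕΣ.when (ι a ∈ᵇ? mapTriple ι t) (ℕΣ.when (ι b ∈ᵇ? mapTriple ι t) 1)
      ≡⟨ ℕΣ.when-⇔ (ι a ∈ᵇ? _) (a ∈ᵇ? t) _ (⁻ t) (⁺ t) ⟩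
    ℕΣ.when (a ∈ᵇ? t) (ℕΣ.when (ι b ∈ᵇ? mapTriple ι t) 1)
      ≡⟨ cong (ℕΣ.when (a ∈ᵇ? t)) (ℕΣ.when-⇔ (ι b ∈ᵇ? _) (b ∈ᵇ? t) 1 (⁻ t) (⁺ t)) ⟩
    ℕΣ.when (a ∈ᵇ? t) (ℕΣ.when (b ∈ᵇ? t) 1)
      ∎) (pairCount-mapTriple ι-inj a b C)
    where
    open ≡-Reasoning
    ⁻ = ∈ᵇ-mapTriple⁻ ι-inj
    ⁺ = ∈ᵇ-mapTriple⁺

pairCount-sym : ∀ {w} (p q : Fin w) C → pairCount p q C ≡ pairCount q p C
pairCount-sym p q [] = refl
pairCount-sym p q (t ∷ C) =
  cong₂ _+_ (ℕΣ.when-when-comm (p ∈ᵇ? t) (q ∈ᵇ? t) 1) (pairCount-sym p q C)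

pairCount-∈ : ∀ {w} {p q : Fin w} {t} C → t ∈ C → p ∈ᵇ t → q ∈ᵇ t → 1 ≤ pairCount p q C
pairCount-∈ {p = p} {q} (t ∷ C) (here refl) p∈ q∈ =
  subst (λ c → 1 ≤ c + pairCount p q C)
        (sym (trans (ℕΣ.when-yes (p ∈ᵇ? t) _ p∈) (ℕΣ.when-yes (q ∈ᵇ? t) 1 q∈))) z<s
pairCount-∈ (_ ∷ C) (there t∈C) p∈ q∈ = ≤-trans (pairCount-∈ C t∈C p∈ q∈) (m≤n+m _ _)

-- A repeated sorted block would cover the pair of its two smallest points twice.
unique-if-pairCount≤1 : ∀ {w} (C : List (Triple w)) → All Sorted C →
  (∀ p q → p ≢ q → pairCount p q C ≤ 1) → Unique C
unique-if-pairCount≤1 [] [] _ = []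
unique-if-pairCount≤1 ((a , b , c) ∷ C) ((a<b , _) ∷ sorted) ≤1 =
  All.tabulate (λ t′∈C t≡t′ → <-irrefl refl (≤-trans (twice t′∈C t≡t′) (≤1 a b a≢b)))
  ∷ unique-if-pairCount≤1 C sorted (λ p q p≢q → ≤-trans (m≤n+m _ _) (≤1 p q p≢q))
  where
  a≢b : a ≢ b
  a≢b a≡b = <-irrefl (cong toℕ a≡b) a<b
  twice : ∀ {t′} → t′ ∈ C → (a , b , c) ≡ t′ → 2 ≤ pairCount a b ((a , b , c) ∷ C)
  twice t′∈C refl = subst (λ m → 2 ≤ m + pairCount a b C)
    (sym (trans (ℕΣ.when-yes (a ∈ᵇ? _) _ (inj₁ refl))
                (ℕΣ.when-yes (b ∈ᵇ? _) 1 (inj₂ (inj₁ refl)))))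
    (s≤s (pairCount-∈ C t′∈C (inj₁ refl) (inj₂ (inj₁ refl))))

ValidWeight : ℕ → ℤ → Set
ValidWeight k z = (z ≢ 0ℤ) × (∣ z ∣ < k)

WellFormed : ∀ {w} → ℕ → Triple w × ℤ → Set
WellFormed k (t , z) = Sorted t × ValidWeight k z

sorted-proj₁ : ∀ {w k} (L : WeightedBlocks w) → All (WellFormed k) L → All Sorted (map proj₁ L)
sorted-proj₁ [] [] = []
sorted-proj₁ (_ ∷ L) ((sorted , _) ∷ wf) = sorted ∷ sorted-proj₁ L wf

valid-weights : ∀ {w k} (L : WeightedBlocks w) → All (WellFormed k) L →
  ∀ i → ValidWeight k (weights L i)
valid-weights (_ ∷ L) ((_ , valid) ∷ wf) zero = valid
valid-weights (_ ∷ L) (_ ∷ wf) (suc i) = valid-weights L wf i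

-- The doubling construction

data SplitAt (a c : ℕ) : Set where
  low  : c < a → SplitAt a c
  high : ∀ d → c ≡ a + d → SplitAt a c

splitAt : ∀ a c → SplitAt a c
splitAt a c with c <? a
... | yes c<a = low c<a
... | no c≮a = high (c ∸ a) (sym (m+[n∸m]≡n (≮⇒≥ c≮a)))

-- The maps y ↦ mate x y (x < n) are n perfect matchings of the complete graph on {0,…,n}
-- that partition its edges.
record IsOneFactorization (n : ℕ) (mate : ℕ → ℕ → ℕ) : Set where
  field
    mate-≤          : ∀ {x y} → x < n → y ≤ n → mate x y ≤ n
    mate-involutive : ∀ {x y} → x < n → y ≤ n → mate x (mate x y) ≡ y
    mate-≢          : ∀ {x y} → x < n → y ≤ n → mate x y ≢ y
    mate-covers     : ∀ {y z} → y ≤ n → z ≤ n → y ≢ z → Σ ℕ λ x → x < n × mate x y ≡ z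
    mate-disjoint   : ∀ {x x′ y} → x < n → x′ < n → y ≤ n → mate x y ≡ mate x′ y → x ≡ x′

-- The edge {y, mate x y} of the x-th matching carries the weight  weight x y.
record WeightedOneFactorization (k n : ℕ) : Set where
  field
    mate               : ℕ → ℕ → ℕ
    weight             : ℕ → ℕ → ℤ
    isOneFactorization : IsOneFactorization n mate
    weight-sym         : ∀ {x y} → x < n → y ≤ n → weight x (mate x y) ≡ weight x y
    weight-valid       : ∀ x y → ValidWeight k (weight x y)
    weight-vertex      : ∀ {y} → y ≤ n → sum< n (λ x → weight x y) ≡ 0ℤ
    weight-factor      : ∀ {x} → x < n → sum< (suc n) (λ y → when (y <? mate x y) (weight x y)) ≡ 0ℤ

  open IsOneFactorization isOneFactorization public

module Doubling {k n : ℕ} (F : WeightedOneFactorization k n) where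

  open WeightedOneFactorization F

  w : ℕ
  w = 2 * n + 1

  w≡1+n+n : w ≡ suc (n + n)
  w≡1+n+n = trans (+-comm (2 * n) 1) (cong (λ m → suc (n + m)) (+-identityʳ n))

  <w : ∀ {c} → c ≤ n + n → c < w
  <w {c} c≤ = subst (c <_) (sym w≡1+n+n) (s≤s c≤)

  old<w : ∀ {x} → x < n → x < w
  old<w x<n = <w (≤-trans (<⇒≤ x<n) (m≤m+n n n))

  new<w : ∀ {y} → y ≤ n → n + y < w
  new<w y≤n = <w (+-monoʳ-≤ n y≤n)

  n≤w : n ≤ w
  n≤w = <⇒≤ (<w (m≤m+n n n))

  ι : Fin n → Fin w
  ι a = inject≤ a n≤w

  ι-injective : ∀ {a b} → ι a ≡ ι b → a ≡ b
  ι-injective {a} {b} eq = toℕ-injective (begin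
    toℕ a      ≡⟨ toℕ-inject≤ a n≤w ⟨
    toℕ (ι a)  ≡⟨ cong toℕ eq ⟩
    toℕ (ι b)  ≡⟨ toℕ-inject≤ b n≤w ⟩
    toℕ b      ∎)
    where open ≡-Reasoning

  toℕ≡⇒≡fromℕ< : ∀ {p : Fin w} {c} .(c<w : c < w) → toℕ p ≡ c → p ≡ fromℕ< c<w
  toℕ≡⇒≡fromℕ< c<w eq = toℕ-injective (trans eq (sym (toℕ-fromℕ< c<w)))

  ≡fromℕ<⇒toℕ≡ : ∀ {p : Fin w} {c} .(c<w : c < w) → p ≡ fromℕ< c<w → toℕ p ≡ c
  ≡fromℕ<⇒toℕ≡ c<w refl = toℕ-fromℕ< c<w

  edgeTriple : ∀ x y → x < n → y ≤ n → Triple w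
  edgeTriple x y x<n y≤n = fromℕ< (old<w x<n) , fromℕ< (new<w y≤n) , fromℕ< (new<w (mate-≤ x<n y≤n))

  edgeBlock : ℕ → ℕ → WeightedBlocks w
  edgeBlock x y with x <? n | y ≤? n | y <? mate x y
  ... | yes x<n | yes y≤n | yes _ = (edgeTriple x y x<n y≤n , weight x y) ∷ []
  ... | _       | _       | _     = []

  edgeBlock-lower : ∀ {x y} (x<n : x < n) (y≤n : y ≤ n) → y < mate x y →
    edgeBlock x y ≡ (edgeTriple x y x<n y≤n , weight x y) ∷ []
  edgeBlock-lower {x} {y} x<n y≤n lower with x <? n | y ≤? n | y <? mate x y
  ... | yes _ | yes _ | yes _ = refl
  ... | no ¬x<n | _ | _ = ⊥-elim (¬x<n x<n)
  ... | yes _ | no ¬y≤n | _ = ⊥-elim (¬y≤n y≤n)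
  ... | yes _ | yes _ | no ¬lower = ⊥-elim (¬lower lower)

  edgeBlock-upper : ∀ {x y} → ¬ y < mate x y → edgeBlock x y ≡ []
  edgeBlock-upper {x} {y} ¬lower with x <? n | y ≤? n | y <? mate x y
  ... | yes _ | yes _ | yes lower = ⊥-elim (¬lower lower)
  ... | yes _ | yes _ | no _ = refl
  ... | yes _ | no _  | _ = refl
  ... | no _  | _     | _ = refl

  OnEdgeTriple : ℕ → ℕ → ℕ → Set
  OnEdgeTriple c x y = (c ≡ x) ⊎ (c ≡ n + y) ⊎ (c ≡ n + mate x y)

  ∈-edgeTriple⁻ : ∀ p {x y} x<n y≤n → p ∈ᵇ edgeTriple x y x<n y≤n → OnEdgeTriple (toℕ p) x y
  ∈-edgeTriple⁻ p _ _ (inj₁ eq) = inj₁ (≡fromℕ<⇒toℕ≡ _ eq)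
  ∈-edgeTriple⁻ p _ _ (inj₂ (inj₁ eq)) = inj₂ (inj₁ (≡fromℕ<⇒toℕ≡ _ eq))
  ∈-edgeTriple⁻ p _ _ (inj₂ (inj₂ eq)) = inj₂ (inj₂ (≡fromℕ<⇒toℕ≡ _ eq))

  ∈-edgeTriple⁺ : ∀ p {x y} x<n y≤n → OnEdgeTriple (toℕ p) x y → p ∈ᵇ edgeTriple x y x<n y≤n
  ∈-edgeTriple⁺ p _ _ (inj₁ eq) = inj₁ (toℕ≡⇒≡fromℕ< _ eq)
  ∈-edgeTriple⁺ p _ _ (inj₂ (inj₁ eq)) = inj₂ (inj₁ (toℕ≡⇒≡fromℕ< _ eq))
  ∈-edgeTriple⁺ p _ _ (inj₂ (inj₂ eq)) = inj₂ (inj₂ (toℕ≡⇒≡fromℕ< _ eq))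

  InEdgeBlock : ℕ → ℕ → ℕ → Set
  InEdgeBlock c x y = y < mate x y × OnEdgeTriple c x y

  flowAt-edgeBlock-∈ : ∀ p {x y} → x < n → y ≤ n → InEdgeBlock (toℕ p) x y →
    flowAt p (edgeBlock x y) ≡ weight x y
  flowAt-edgeBlock-∈ p x<n y≤n (lower , on) rewrite edgeBlock-lower x<n y≤n lower =
    trans (ℤP.+-identityʳ _) (when-yes (p ∈ᵇ? _) _ (∈-edgeTriple⁺ p x<n y≤n on))

  flowAt-edgeBlock-∉ : ∀ p {x y} → x < n → y ≤ n → ¬ InEdgeBlock (toℕ p) x y →
    flowAt p (edgeBlock x y) ≡ 0ℤ
  flowAt-edgeBlock-∉ p {x} {y} x<n y≤n ∉block = byCases (y <? mate x y)
    where
    byCases : Dec (y < mate x y) → flowAt p (edgeBlock x y) ≡ 0ℤ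
    byCases (no ¬lower) rewrite edgeBlock-upper {x} ¬lower = refl
    byCases (yes lower) rewrite edgeBlock-lower x<n y≤n lower =
      trans (ℤP.+-identityʳ _)
            (when-no (p ∈ᵇ? _) _ λ p∈ → ∉block (lower , ∈-edgeTriple⁻ p x<n y≤n p∈))

  pairCount-edgeBlock-∈ : ∀ p q {x y} → x < n → y ≤ n → y < mate x y →
    OnEdgeTriple (toℕ p) x y → OnEdgeTriple (toℕ q) x y → pairCount p q (map proj₁ (edgeBlock x y)) ≡ 1
  pairCount-edgeBlock-∈ p q x<n y≤n lower onp onq rewrite edgeBlock-lower x<n y≤n lower =
    trans (+-identityʳ _) (trans (ℕΣ.when-yes (p ∈ᵇ? _) _ (∈-edgeTriple⁺ p x<n y≤n onp))
                                 (ℕΣ.when-yes (q ∈ᵇ? _) 1 (∈-edgeTriple⁺ q x<n y≤n onq)))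

  pairCount-edgeBlock-∉ : ∀ p q {x y} → x < n → y ≤ n →
    ¬ (InEdgeBlock (toℕ p) x y × OnEdgeTriple (toℕ q) x y) →
    pairCount p q (map proj₁ (edgeBlock x y)) ≡ 0
  pairCount-edgeBlock-∉ p q {x} {y} x<n y≤n ¬both = byCases (y <? mate x y)
    where
    byCases : Dec (y < mate x y) → pairCount p q (map proj₁ (edgeBlock x y)) ≡ 0
    byCases (no ¬lower) rewrite edgeBlock-upper {x} ¬lower = refl
    byCases (yes lower) rewrite edgeBlock-lower x<n y≤n lower =
      trans (+-identityʳ _) (ℕΣ.when-when-no (p ∈ᵇ? _) (q ∈ᵇ? _) 1 λ p∈ q∈ →
        ¬both ((lower , ∈-edgeTriple⁻ p x<n y≤n p∈) , ∈-edgeTriple⁻ q x<n y≤n q∈))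

  Endpoint : ℕ → ℕ → ℕ → Set
  Endpoint x u y = (u ≡ y) ⊎ (u ≡ mate x y)

  lowEnd : ℕ → ℕ → ℕ
  lowEnd x u with u <? mate x u
  ... | yes _ = u
  ... | no _ = mate x u

  module _ {x u} (x<n : x < n) (u≤n : u ≤ n) where

    lowEnd-≤ : lowEnd x u ≤ n
    lowEnd-≤ with u <? mate x u
    ... | yes _ = u≤n
    ... | no _ = mate-≤ x<n u≤n

    lowEnd-lower : lowEnd x u < mate x (lowEnd x u)
    lowEnd-lower with u <? mate x u
    ... | yes u<mate = u<mate
    ... | no u≮mate =
      subst (mate x u <_) (sym (mate-involutive x<n u≤n)) (≤∧≢⇒< (≮⇒≥ u≮mate) (mate-≢ x<n u≤n))

    lowEnd-endpoint : Endpoint x u (lowEnd x u)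
    lowEnd-endpoint with u <? mate x u
    ... | yes _ = inj₁ refl
    ... | no _ = inj₂ (sym (mate-involutive x<n u≤n))

    mate-endpoint-lowEnd : Endpoint x (mate x u) (lowEnd x u)
    mate-endpoint-lowEnd with u <? mate x u
    ... | yes _ = inj₂ refl
    ... | no _ = inj₁ refl

    weight-lowEnd : weight x (lowEnd x u) ≡ weight x u
    weight-lowEnd with u <? mate x u
    ... | yes _ = refl
    ... | no _ = weight-sym x<n u≤n

    lowEnd-unique : ∀ {y} → y ≤ n → y < mate x y → Endpoint x u y → y ≡ lowEnd x u
    lowEnd-unique {y} y≤n y<mate end with u <? mate x u | end
    ... | yes _      | inj₁ refl = refl
    ... | yes u<mate | inj₂ refl = ⊥-elim (<-asym y<mate (subst (mate x y <_) (mate-involutive x<n y≤n) u<mate))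
    ... | no u≮mate  | inj₁ refl = ⊥-elim (u≮mate y<mate)
    ... | no _       | inj₂ refl = sym (mate-involutive x<n y≤n)

  endpoints-mate : ∀ {x u u′ y} → x < n → y ≤ n → u ≢ u′ →
    Endpoint x u y → Endpoint x u′ y → mate x u ≡ u′
  endpoints-mate x<n y≤n u≢u′ (inj₁ refl) (inj₁ refl) = ⊥-elim (u≢u′ refl)
  endpoints-mate x<n y≤n u≢u′ (inj₁ refl) (inj₂ refl) = refl
  endpoints-mate x<n y≤n u≢u′ (inj₂ refl) (inj₁ refl) = mate-involutive x<n y≤n
  endpoints-mate x<n y≤n u≢u′ (inj₂ refl) (inj₂ refl) = ⊥-elim (u≢u′ refl)

  onEdgeTriple-new⁻ : ∀ {c x u y} → x < n → c ≡ n + u → OnEdgeTriple c x y → Endpoint x u y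
  onEdgeTriple-new⁻ x<n refl (inj₁ eq) = ⊥-elim (<-irrefl (sym eq) (≤-trans x<n (m≤m+n n _)))
  onEdgeTriple-new⁻ x<n refl (inj₂ (inj₁ eq)) = inj₁ (+-cancelˡ-≡ n _ _ eq)
  onEdgeTriple-new⁻ x<n refl (inj₂ (inj₂ eq)) = inj₂ (+-cancelˡ-≡ n _ _ eq)

  onEdgeTriple-new⁺ : ∀ {c x u y} → c ≡ n + u → Endpoint x u y → OnEdgeTriple c x y
  onEdgeTriple-new⁺ refl (inj₁ eq) = inj₂ (inj₁ (cong (n +_) eq))
  onEdgeTriple-new⁺ refl (inj₂ eq) = inj₂ (inj₂ (cong (n +_) eq))

  onEdgeTriple-old⁻ : ∀ {c x y} → c < n → OnEdgeTriple c x y → c ≡ x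
  onEdgeTriple-old⁻ c<n (inj₁ eq) = eq
  onEdgeTriple-old⁻ c<n (inj₂ (inj₁ eq)) = ⊥-elim (<-irrefl eq (≤-trans c<n (m≤m+n n _)))
  onEdgeTriple-old⁻ c<n (inj₂ (inj₂ eq)) = ⊥-elim (<-irrefl eq (≤-trans c<n (m≤m+n n _)))

  newBlocks : WeightedBlocks w
  newBlocks = concat (applyUpTo (λ x → concat (applyUpTo (edgeBlock x) (suc n))) n)

  edgeFlow : Fin w → ℕ → ℕ → ℤ
  edgeFlow p x y = flowAt p (edgeBlock x y)

  edgeCount : Fin w → Fin w → ℕ → ℕ → ℕ
  edgeCount p q x y = pairCount p q (map proj₁ (edgeBlock x y))

  flowAt-newBlocks : ∀ p → flowAt p newBlocks ≡ sum< n (λ x → sum< (suc n) (edgeFlow p x))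
  flowAt-newBlocks p = trans (flowAt-concat p n _) (sum<-cong n λ x _ → flowAt-concat p (suc n) (edgeBlock x))

  pairCount-newBlocks : ∀ p q →
    pairCount p q (map proj₁ newBlocks) ≡ ℕΣ.sum< n (λ x → ℕΣ.sum< (suc n) (edgeCount p q x))
  pairCount-newBlocks p q =
    trans (pairCount-concat p q n _) (ℕΣ.sum<-cong n λ x _ → pairCount-concat p q (suc n) (edgeBlock x))

  flowAt-newBlocks-new : ∀ p u → u ≤ n → toℕ p ≡ n + u → flowAt p newBlocks ≡ 0ℤ
  flowAt-newBlocks-new p u u≤n p≡ =
    trans (flowAt-newBlocks p) (trans (sum<-cong n atFactor) (weight-vertex u≤n))
    where
    atFactor : ∀ x → x < n → sum< (suc n) (edgeFlow p x) ≡ weight x u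
    atFactor x x<n = begin
      sum< (suc n) (edgeFlow p x)  ≡⟨ sum<-single (suc n) (lowEnd x u) (s≤s (lowEnd-≤ x<n u≤n)) others ⟩
      edgeFlow p x (lowEnd x u)    ≡⟨ flowAt-edgeBlock-∈ p x<n (lowEnd-≤ x<n u≤n) inBlock ⟩
      weight x (lowEnd x u)        ≡⟨ weight-lowEnd x<n u≤n ⟩
      weight x u                   ∎
      where
      open ≡-Reasoning
      inBlock : InEdgeBlock (toℕ p) x (lowEnd x u)
      inBlock = lowEnd-lower x<n u≤n , onEdgeTriple-new⁺ p≡ (lowEnd-endpoint x<n u≤n)
      others : ∀ y → y < suc n → y ≢ lowEnd x u → edgeFlow p x y ≡ 0ℤ
      others y y<1+n y≢ = flowAt-edgeBlock-∉ p x<n (s≤s⁻¹ y<1+n) λ (lower , on) →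
        y≢ (lowEnd-unique x<n u≤n (s≤s⁻¹ y<1+n) lower (onEdgeTriple-new⁻ x<n p≡ on))

  flowAt-newBlocks-old : ∀ p → toℕ p < n → flowAt p newBlocks ≡ 0ℤ
  flowAt-newBlocks-old p c<n = begin
    flowAt p newBlocks                                       ≡⟨ flowAt-newBlocks p ⟩
    sum< n (λ x → sum< (suc n) (edgeFlow p x))               ≡⟨ sum<-single n c c<n otherFactors ⟩
    sum< (suc n) (edgeFlow p c)                              ≡⟨ sum<-cong (suc n) atEdge ⟩
    sum< (suc n) (λ y → when (y <? mate c y) (weight c y))   ≡⟨ weight-factor c<n ⟩
    0ℤ                                                       ∎
    where
    open ≡-Reasoning
    c = toℕ p
    otherFactors : ∀ x → x < n → x ≢ c → sum< (suc n) (edgeFlow p x) ≡ 0ℤ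
    otherFactors x x<n x≢c = sum<-zero (suc n) λ y y<1+n →
      flowAt-edgeBlock-∉ p x<n (s≤s⁻¹ y<1+n) λ (_ , on) → x≢c (sym (onEdgeTriple-old⁻ c<n on))
    atEdge : ∀ y → y < suc n → edgeFlow p c y ≡ when (y <? mate c y) (weight c y)
    atEdge y y<1+n = byCases (y <? mate c y)
      where
      byCases : (d : Dec (y < mate c y)) → edgeFlow p c y ≡ when d (weight c y)
      byCases (yes lower) = flowAt-edgeBlock-∈ p c<n (s≤s⁻¹ y<1+n) (lower , inj₁ refl)
      byCases (no ¬lower) = flowAt-edgeBlock-∉ p c<n (s≤s⁻¹ y<1+n) (¬lower ∘ proj₁)

  pairCount-newBlocks-old-old : ∀ p q → toℕ p < n → toℕ q < n → p ≢ q →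
    pairCount p q (map proj₁ newBlocks) ≡ 0
  pairCount-newBlocks-old-old p q p<n q<n p≢q = trans (pairCount-newBlocks p q) (ℕΣ.sum<-zero n λ x x<n →
    ℕΣ.sum<-zero (suc n) λ y y<1+n → pairCount-edgeBlock-∉ p q x<n (s≤s⁻¹ y<1+n) λ ((_ , onp) , onq) →
      p≢q (toℕ-injective (trans (onEdgeTriple-old⁻ p<n onp) (sym (onEdgeTriple-old⁻ q<n onq)))))

  pairCount-newBlocks-old-new : ∀ p q u → toℕ p < n → u ≤ n → toℕ q ≡ n + u →
    pairCount p q (map proj₁ newBlocks) ≡ 1
  pairCount-newBlocks-old-new p q u c<n u≤n q≡ =
    trans (pairCount-newBlocks p q) (trans (ℕΣ.sum<-single n c c<n otherFactors) atFactor)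
    where
    c = toℕ p
    otherFactors : ∀ x → x < n → x ≢ c → ℕΣ.sum< (suc n) (edgeCount p q x) ≡ 0
    otherFactors x x<n x≢c = ℕΣ.sum<-zero (suc n) λ y y<1+n →
      pairCount-edgeBlock-∉ p q x<n (s≤s⁻¹ y<1+n) λ ((_ , onp) , _) →
        x≢c (sym (onEdgeTriple-old⁻ c<n onp))
    others : ∀ y → y < suc n → y ≢ lowEnd c u → edgeCount p q c y ≡ 0
    others y y<1+n y≢ = pairCount-edgeBlock-∉ p q c<n (s≤s⁻¹ y<1+n) λ ((lower , _) , onq) →
      y≢ (lowEnd-unique c<n u≤n (s≤s⁻¹ y<1+n) lower (onEdgeTriple-new⁻ c<n q≡ onq))
    atFactor : ℕΣ.sum< (suc n) (edgeCount p q c) ≡ 1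
    atFactor = trans (ℕΣ.sum<-single (suc n) (lowEnd c u) (s≤s (lowEnd-≤ c<n u≤n)) others)
      (pairCount-edgeBlock-∈ p q c<n (lowEnd-≤ c<n u≤n) (lowEnd-lower c<n u≤n)
        (inj₁ refl) (onEdgeTriple-new⁺ q≡ (lowEnd-endpoint c<n u≤n)))

  pairCount-newBlocks-new-new : ∀ p q u u′ → u ≤ n → u′ ≤ n →
    toℕ p ≡ n + u → toℕ q ≡ n + u′ → u ≢ u′ →
    pairCount p q (map proj₁ newBlocks) ≡ 1
  pairCount-newBlocks-new-new p q u u′ u≤n u′≤n p≡ q≡ u≢u′ with mate-covers u≤n u′≤n u≢u′
  ... | x₀ , x₀<n , mate-x₀ =
    trans (pairCount-newBlocks p q) (trans (ℕΣ.sum<-single n x₀ x₀<n otherFactors) atFactor)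
    where
    otherFactors : ∀ x → x < n → x ≢ x₀ → ℕΣ.sum< (suc n) (edgeCount p q x) ≡ 0
    otherFactors x x<n x≢x₀ = ℕΣ.sum<-zero (suc n) λ y y<1+n →
      pairCount-edgeBlock-∉ p q x<n (s≤s⁻¹ y<1+n) λ ((_ , onp) , onq) →
        x≢x₀ (mate-disjoint x<n x₀<n u≤n (trans
          (endpoints-mate x<n (s≤s⁻¹ y<1+n) u≢u′
            (onEdgeTriple-new⁻ x<n p≡ onp) (onEdgeTriple-new⁻ x<n q≡ onq))
          (sym mate-x₀)))
    others : ∀ y → y < suc n → y ≢ lowEnd x₀ u → edgeCount p q x₀ y ≡ 0
    others y y<1+n y≢ = pairCount-edgeBlock-∉ p q x₀<n (s≤s⁻¹ y<1+n) λ ((lower , onp) , _) →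
      y≢ (lowEnd-unique x₀<n u≤n (s≤s⁻¹ y<1+n) lower (onEdgeTriple-new⁻ x₀<n p≡ onp))
    atFactor : ℕΣ.sum< (suc n) (edgeCount p q x₀) ≡ 1
    atFactor = trans (ℕΣ.sum<-single (suc n) (lowEnd x₀ u) (s≤s (lowEnd-≤ x₀<n u≤n)) others)
      (pairCount-edgeBlock-∈ p q x₀<n (lowEnd-≤ x₀<n u≤n) (lowEnd-lower x₀<n u≤n)
        (onEdgeTriple-new⁺ p≡ (lowEnd-endpoint x₀<n u≤n))
        (onEdgeTriple-new⁺ q≡
          (subst (λ e → Endpoint x₀ e (lowEnd x₀ u)) mate-x₀ (mate-endpoint-lowEnd x₀<n u≤n))))

  oldBlocks : (B : List (Triple n)) → (Fin (length B) → ℤ) → WeightedBlocks w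
  oldBlocks [] f = []
  oldBlocks (t ∷ B) f = (mapTriple ι t , f zero) ∷ oldBlocks B (f ∘ suc)

  map-proj₁-oldBlocks : ∀ B f → map proj₁ (oldBlocks B f) ≡ map (mapTriple ι) B
  map-proj₁-oldBlocks [] f = refl
  map-proj₁-oldBlocks (t ∷ B) f = cong (mapTriple ι t ∷_) (map-proj₁-oldBlocks B (f ∘ suc))

  ∉-mapTriple : ∀ {p} t → n ≤ toℕ p → ¬ p ∈ᵇ mapTriple ι t
  ∉-mapTriple {p} t n≤p p∈ = <-irrefl refl (≤-<-trans n≤p (old p∈))
    where
    <n : ∀ {a} → p ≡ ι a → toℕ p < n
    <n {a} refl = subst (_< n) (sym (toℕ-inject≤ a n≤w)) (toℕ<n a)
    old : p ∈ᵇ mapTriple ι t → toℕ p < n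
    old (inj₁ eq) = <n eq
    old (inj₂ (inj₁ eq)) = <n eq
    old (inj₂ (inj₂ eq)) = <n eq

  flowAt-oldBlocks-old : ∀ a B f →
    flowAt (ι a) (oldBlocks B f) ≡ sum (λ i → when (a ∈ᵇ? lookup B i) (f i))
  flowAt-oldBlocks-old a [] f = refl
  flowAt-oldBlocks-old a (t ∷ B) f = cong₂ _+ℤ_
    (when-⇔ (ι a ∈ᵇ? mapTriple ι t) (a ∈ᵇ? t) (f zero) (∈ᵇ-mapTriple⁻ ι-injective t) (∈ᵇ-mapTriple⁺ t))
    (flowAt-oldBlocks-old a B (f ∘ suc))

  flowAt-oldBlocks-new : ∀ p B f → n ≤ toℕ p → flowAt p (oldBlocks B f) ≡ 0ℤ
  flowAt-oldBlocks-new p [] f n≤p = refl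
  flowAt-oldBlocks-new p (t ∷ B) f n≤p =
    cong₂ _+ℤ_ (when-no (p ∈ᵇ? mapTriple ι t) _ (∉-mapTriple t n≤p))
               (flowAt-oldBlocks-new p B (f ∘ suc) n≤p)

  pairCount-oldBlocks-new : ∀ p q B → n ≤ toℕ p ⊎ n ≤ toℕ q →
    pairCount p q (map (mapTriple ι) B) ≡ 0
  pairCount-oldBlocks-new p q [] _ = refl
  pairCount-oldBlocks-new p q (t ∷ B) new = cong₂ _+_
    (ℕΣ.when-when-no (p ∈ᵇ? mapTriple ι t) (q ∈ᵇ? mapTriple ι t) 1 λ p∈ q∈ →
      [ (λ n≤p → ∉-mapTriple t n≤p p∈) , (λ n≤q → ∉-mapTriple t n≤q q∈) ]′ new)
    (pairCount-oldBlocks-new p q B new)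

  high-≤ : ∀ {p : Fin w} u → toℕ p ≡ n + u → u ≤ n
  high-≤ {p} u p≡ = +-cancelˡ-≤ n u n (s≤s⁻¹ (subst₂ _<_ p≡ w≡1+n+n (toℕ<n p)))

  ι-fromℕ< : ∀ {p : Fin w} (p<n : toℕ p < n) → ι (fromℕ< p<n) ≡ p
  ι-fromℕ< p<n = toℕ-injective (trans (toℕ-inject≤ _ n≤w) (toℕ-fromℕ< p<n))

  sorted-mapTriple : ∀ {t} → Sorted t → Sorted (mapTriple ι t)
  sorted-mapTriple {a , b , c} (a<b , b<c) =
    subst₂ _<_ (sym (toℕ-inject≤ a n≤w)) (sym (toℕ-inject≤ b n≤w)) a<b ,
    subst₂ _<_ (sym (toℕ-inject≤ b n≤w)) (sym (toℕ-inject≤ c n≤w)) b<c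

  sorted-edgeTriple : ∀ {x y} x<n y≤n → y < mate x y → Sorted (edgeTriple x y x<n y≤n)
  sorted-edgeTriple {x} {y} x<n y≤n y<mate =
    subst₂ _<_ (sym (toℕ-fromℕ< (old<w x<n))) (sym (toℕ-fromℕ< (new<w y≤n)))
      (≤-trans x<n (m≤m+n n y)) ,
    subst₂ _<_ (sym (toℕ-fromℕ< (new<w y≤n))) (sym (toℕ-fromℕ< (new<w (mate-≤ x<n y≤n))))
      (+-monoʳ-< n y<mate)

  edgeBlock-wellFormed : ∀ x y → All (WellFormed k) (edgeBlock x y)
  edgeBlock-wellFormed x y with x <? n | y ≤? n | y <? mate x y
  ... | yes x<n | yes y≤n | yes y<mate = (sorted-edgeTriple x<n y≤n y<mate , weight-valid x y) ∷ []
  ... | yes _   | yes _   | no _ = []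
  ... | yes _   | no _    | _ = []
  ... | no _    | _       | _ = []

  newBlocks-wellFormed : All (WellFormed k) newBlocks
  newBlocks-wellFormed =
    concat⁺ (applyUpTo⁺₂ _ n λ x → concat⁺ (applyUpTo⁺₂ _ (suc n) (edgeBlock-wellFormed x)))

  oldBlocks-wellFormed : ∀ B f → All Sorted B → (∀ i → ValidWeight k (f i)) →
    All (WellFormed k) (oldBlocks B f)
  oldBlocks-wellFormed [] f [] valid = []
  oldBlocks-wellFormed (t ∷ B) f (sorted ∷ sorteds) valid =
    (sorted-mapTriple sorted , valid zero) ∷ oldBlocks-wellFormed B (f ∘ suc) sorteds (valid ∘ suc)

  doubledBlocks : (B : List (Triple n)) → (Fin (length B) → ℤ) → WeightedBlocks w
  doubledBlocks B f = oldBlocks B f ++ newBlocks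

  module _ (B : List (Triple n)) (f : Fin (length B) → ℤ) where

    pairCount-doubledBlocks : ∀ p q → pairCount p q (map proj₁ (doubledBlocks B f)) ≡
      pairCount p q (map (mapTriple ι) B) + pairCount p q (map proj₁ newBlocks)
    pairCount-doubledBlocks p q = begin
      pairCount p q (map proj₁ (oldBlocks B f ++ newBlocks))
        ≡⟨ cong (pairCount p q) (map-++ proj₁ (oldBlocks B f) newBlocks) ⟩
      pairCount p q (map proj₁ (oldBlocks B f) ++ map proj₁ newBlocks)
        ≡⟨ pairCount-++ p q (map proj₁ (oldBlocks B f)) _ ⟩
      pairCount p q (map proj₁ (oldBlocks B f)) + pairCount p q (map proj₁ newBlocks)
        ≡⟨ cong (λ C → pairCount p q C + _) (map-proj₁-oldBlocks B f) ⟩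
      pairCount p q (map (mapTriple ι) B) + pairCount p q (map proj₁ newBlocks)  ∎
      where open ≡-Reasoning

    doubledBlocks-steiner : IsSTS n B → ∀ p q → p ≢ q →
      pairCount p q (map proj₁ (doubledBlocks B f)) ≡ 1
    doubledBlocks-steiner sts p q p≢q rewrite pairCount-doubledBlocks p q
      with splitAt n (toℕ p) | splitAt n (toℕ q)
    ... | low p<n | low q<n = cong₂ _+_ old-old (pairCount-newBlocks-old-old p q p<n q<n p≢q)
      where
      a = fromℕ< p<n
      b = fromℕ< q<n
      old-old : pairCount p q (map (mapTriple ι) B) ≡ 1
      old-old = begin
        pairCount p q (map (mapTriple ι) B)
          ≡⟨ cong₂ (λ p′ q′ → pairCount p′ q′ (map (mapTriple ι) B)) (ι-fromℕ< p<n) (ι-fromℕ< q<n) ⟨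
        pairCount (ι a) (ι b) (map (mapTriple ι) B)
          ≡⟨ pairCount-mapTriple ι-injective a b B ⟩
        pairCount a b B
          ≡⟨ length-blocksAt₂ B a b ⟨
        length (blocksAt₂ B a b)
          ≡⟨ IsSTS.steiner sts a b a≢b ⟩
        1 ∎
        where
        open ≡-Reasoning
        a≢b : a ≢ b
        a≢b a≡b = p≢q (trans (sym (ι-fromℕ< p<n)) (trans (cong ι a≡b) (ι-fromℕ< q<n)))
    ... | low p<n | high u q≡ = cong₂ _+_
      (pairCount-oldBlocks-new p q B (inj₂ (subst (n ≤_) (sym q≡) (m≤m+n n u))))
      (pairCount-newBlocks-old-new p q u p<n (high-≤ u q≡) q≡)
    ... | high u p≡ | low q<n = cong₂ _+_
      (pairCount-oldBlocks-new p q B (inj₁ (subst (n ≤_) (sym p≡) (m≤m+n n u))))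
      (trans (pairCount-sym p q (map proj₁ newBlocks))
             (pairCount-newBlocks-old-new q p u q<n (high-≤ u p≡) p≡))
    ... | high u p≡ | high u′ q≡ = cong₂ _+_
      (pairCount-oldBlocks-new p q B (inj₁ (subst (n ≤_) (sym p≡) (m≤m+n n u))))
      (pairCount-newBlocks-new-new p q u u′ (high-≤ u p≡) (high-≤ u′ q≡) p≡ q≡
        (λ u≡u′ → p≢q (toℕ-injective (trans p≡ (trans (cong (n +_) u≡u′) (sym q≡))))))

    doubledBlocks-zeroSum : (∀ a → foldr _+ℤ_ 0ℤ (map f (blocksAt B a)) ≡ 0ℤ) →
      ∀ p → flowAt p (doubledBlocks B f) ≡ 0ℤ
    doubledBlocks-zeroSum f-zeroSum p rewrite flowAt-++ p (oldBlocks B f) newBlocks with splitAt n (toℕ p)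
    ... | low p<n = cong₂ _+ℤ_ old (flowAt-newBlocks-old p p<n)
      where
      a = fromℕ< p<n
      old : flowAt p (oldBlocks B f) ≡ 0ℤ
      old = begin
        flowAt p (oldBlocks B f)                    ≡⟨ cong (λ p′ → flowAt p′ (oldBlocks B f)) (ι-fromℕ< p<n) ⟨
        flowAt (ι a) (oldBlocks B f)                ≡⟨ flowAt-oldBlocks-old a B f ⟩
        sum (λ i → when (a ∈ᵇ? lookup B i) (f i))   ≡⟨ foldr-blocksAt B f a ⟨
        foldr _+ℤ_ 0ℤ (map f (blocksAt B a))        ≡⟨ f-zeroSum a ⟩
        0ℤ                                          ∎
        where open ≡-Reasoning
    ... | high u p≡ = cong₂ _+ℤ_
      (flowAt-oldBlocks-new p B f (subst (n ≤_) (sym p≡) (m≤m+n n u)))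
      (flowAt-newBlocks-new p u (high-≤ u p≡) p≡)

    oldBlocks-embedded : ∀ {t} → t ∈ B → mapTriple ι t ∈ map proj₁ (doubledBlocks B f)
    oldBlocks-embedded {t} t∈B = subst (mapTriple ι t ∈_) (sym (map-++ proj₁ (oldBlocks B f) newBlocks))
      (∈-++⁺ˡ (subst (mapTriple ι t ∈_) (sym (map-proj₁-oldBlocks B f)) (∈-map⁺ (mapTriple ι) t∈B)))

  doubling : (B : List (Triple n)) → IsSTS n B → HasZeroSumFlow k B →
    Σ (List (Triple w)) λ C → IsSTS w C × HasZeroSumFlow k C × EmbedsIn B C
  doubling B sts (f , f≢0 , f<k , f-zeroSum) =
    C , isSTS , (weights L , proj₁ ∘ valid , proj₂ ∘ valid , zeroSum) , embedding
    where
    L = doubledBlocks B f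
    C = map proj₁ L
    wellFormed : All (WellFormed k) L
    wellFormed = ++⁺ (oldBlocks-wellFormed B f (IsSTS.sorted sts) (λ i → f≢0 i , f<k i)) newBlocks-wellFormed
    valid = valid-weights L wellFormed
    steiner = doubledBlocks-steiner B f sts
    isSTS : IsSTS w C
    isSTS = record
      { sorted  = sorted-proj₁ L wellFormed
      ; unique  = unique-if-pairCount≤1 C (sorted-proj₁ L wellFormed) (λ p q → ≤-reflexive ∘ steiner p q)
      ; steiner = λ p q p≢q → trans (length-blocksAt₂ C p q) (steiner p q p≢q)
      }
    zeroSum : ∀ p → foldr _+ℤ_ 0ℤ (map (weights L) (blocksAt C p)) ≡ 0ℤ
    zeroSum p = trans (foldr-blocksAt C (weights L) p)
                      (trans (sym (flowAt-as-sum L p)) (doubledBlocks-zeroSum B f f-zeroSum p))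
    embedding : EmbedsIn B C
    embedding = ι , ι-injective , All.tabulate λ {t} t∈B →
      mapTriple ι t , oldBlocks-embedded B f t∈B , λ _ z∈ → z∈

-- Modular arithmetic and the round-robin factorization

module Modular (M : ℕ) .{{_ : NonZero M}} where

  infix 4 _≈_
  record _≈_ (x y : ℕ) : Set where
    constructor ≈-intro
    field %-≡ : x % M ≡ y % M

  ≈-isEquivalence : IsEquivalence _≈_
  ≈-isEquivalence = record
    { refl  = ≈-intro refl
    ; sym   = λ (≈-intro eq) → ≈-intro (sym eq)
    ; trans = λ (≈-intro eq) (≈-intro eq′) → ≈-intro (trans eq eq′)
    }

  ≈-setoid : Setoid 0ℓ 0ℓ
  ≈-setoid = record { isEquivalence = ≈-isEquivalence }

  open IsEquivalence ≈-isEquivalence public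
    using () renaming (refl to ≈-refl; sym to ≈-sym; trans to ≈-trans; reflexive to ≡⇒≈)

  %-≈ : ∀ x → x % M ≈ x
  %-≈ x = ≈-intro (m%n%n≡m%n x M)

  +-≈ : ∀ {a a′ b b′} → a ≈ a′ → b ≈ b′ → a + b ≈ a′ + b′
  +-≈ {a} {a′} {b} {b′} (≈-intro eq) (≈-intro eq′) = ≈-intro (begin
    (a + b) % M                ≡⟨ %-distribˡ-+ a b M ⟩
    (a % M + b % M) % M        ≡⟨ cong₂ (λ u v → (u + v) % M) eq eq′ ⟩
    (a′ % M + b′ % M) % M      ≡⟨ %-distribˡ-+ a′ b′ M ⟨
    (a′ + b′) % M              ∎)
    where open ≡-Reasoning

  *-≈ : ∀ {a a′ b b′} → a ≈ a′ → b ≈ b′ → a * b ≈ a′ * b′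
  *-≈ {a} {a′} {b} {b′} (≈-intro eq) (≈-intro eq′) = ≈-intro (begin
    (a * b) % M                ≡⟨ %-distribˡ-* a b M ⟩
    (a % M * (b % M)) % M      ≡⟨ cong₂ (λ u v → (u * v) % M) eq eq′ ⟩
    (a′ % M * (b′ % M)) % M    ≡⟨ %-distribˡ-* a′ b′ M ⟨
    (a′ * b′) % M              ∎)
    where open ≡-Reasoning

  +-*-≈ : ∀ a k → a + k * M ≈ a
  +-*-≈ a k = ≈-intro ([m+kn]%n≡m%n a k M)

  +-∸-≈ : ∀ a {c} → c ≤ M → a + (M ∸ c) + c ≈ a
  +-∸-≈ a {c} c≤M =
    ≈-trans (≡⇒≈ (trans (+-assoc a (M ∸ c) c) (cong (a +_) (m∸n+n≡m c≤M))))
            (≈-intro ([m+n]%n≡m%n a M))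

  +-cancelʳ-≈ : ∀ {a b} c → a + c ≈ b + c → a ≈ b
  +-cancelʳ-≈ {a} {b} c a+c≈b+c = begin
    a                      ≈⟨ +-∸-≈ a c%<M ⟨
    a + (M ∸ c%) + c%      ≈⟨ ≡⇒≈ (xy∙z≈xz∙y a (M ∸ c%) c%) ⟩
    a + c% + (M ∸ c%)      ≈⟨ +-≈ (+-≈ (≈-refl {a}) (%-≈ c)) ≈-refl ⟩
    a + c + (M ∸ c%)       ≈⟨ +-≈ a+c≈b+c ≈-refl ⟩
    b + c + (M ∸ c%)       ≈⟨ +-≈ (+-≈ (≈-refl {b}) (%-≈ c)) ≈-refl ⟨
    b + c% + (M ∸ c%)      ≈⟨ ≡⇒≈ (xy∙z≈xz∙y b c% (M ∸ c%)) ⟩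
    b + (M ∸ c%) + c%      ≈⟨ +-∸-≈ b c%<M ⟩
    b                      ∎
    where
    open import Relation.Binary.Reasoning.Setoid ≈-setoid
    open import Algebra.Properties.CommutativeSemigroup +-commutativeSemigroup using (xy∙z≈xz∙y)
    c% = c % M
    c%<M = <⇒≤ (m%n<n c M)

  ≈⇒≡ : ∀ {a b} → a < M → b < M → a ≈ b → a ≡ b
  ≈⇒≡ a<M b<M (≈-intro eq) = trans (sym (m<n⇒m%n≡m a<M)) (trans eq (m<n⇒m%n≡m b<M))

  infixl 6 _⊕_ _⊖_

  _⊕_ : ℕ → ℕ → ℕ
  a ⊕ b = (a + b) % M

  _⊖_ : ℕ → ℕ → ℕ
  a ⊖ b = (a + (M ∸ b)) % M

  ⊕-< : ∀ a b → a ⊕ b < M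
  ⊕-< a b = m%n<n (a + b) M

  ⊖-< : ∀ a b → a ⊖ b < M
  ⊖-< a b = m%n<n (a + (M ∸ b)) M

  [m⊖n]+n≈m : ∀ m {n} → n ≤ M → m ⊖ n + n ≈ m
  [m⊖n]+n≈m m {n} n≤M = ≈-trans (+-≈ (%-≈ (m + (M ∸ n))) ≈-refl) (+-∸-≈ m n≤M)

  [m⊕n]⊖n≡m : ∀ {m n} → m < M → n ≤ M → (m ⊕ n) ⊖ n ≡ m
  [m⊕n]⊖n≡m {m} {n} m<M n≤M = ≈⇒≡ (⊖-< (m ⊕ n) n) m<M
    (+-cancelʳ-≈ n (≈-trans ([m⊖n]+n≈m (m ⊕ n) n≤M) (%-≈ (m + n))))

  [m⊖n]⊕n≡m : ∀ {m n} → m < M → n ≤ M → (m ⊖ n) ⊕ n ≡ m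
  [m⊖n]⊕n≡m {m} {n} m<M n≤M =
    ≈⇒≡ (⊕-< (m ⊖ n) n) m<M (≈-trans (%-≈ (m ⊖ n + n)) ([m⊖n]+n≈m m n≤M))

  m⊕[n⊖m]≡n : ∀ {m n} → m ≤ M → n < M → m ⊕ (n ⊖ m) ≡ n
  m⊕[n⊖m]≡n {m} {n} m≤M n<M = ≈⇒≡ (⊕-< m (n ⊖ m)) n<M
    (≈-trans (%-≈ (m + (n ⊖ m))) (≈-trans (≡⇒≈ (+-comm m (n ⊖ m))) ([m⊖n]+n≈m n m≤M)))

  m⊖[m⊖n]≡n : ∀ {m n} → n < M → m ⊖ (m ⊖ n) ≡ n
  m⊖[m⊖n]≡n {m} {n} n<M = ≈⇒≡ (⊖-< m (m ⊖ n)) n<M (+-cancelʳ-≈ (m ⊖ n)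
    (≈-trans ([m⊖n]+n≈m m (<⇒≤ (⊖-< m n)))
             (≈-trans (≈-sym ([m⊖n]+n≈m m (<⇒≤ n<M))) (≡⇒≈ (+-comm (m ⊖ n) n)))))

  ⊕-cancelˡ : ∀ {m n n′} → n < M → n′ < M → m ⊕ n ≡ m ⊕ n′ → n ≡ n′
  ⊕-cancelˡ {m} {n} {n′} n<M n′<M eq = ≈⇒≡ n<M n′<M (+-cancelʳ-≈ m
    (≈-trans (≡⇒≈ (+-comm n m)) (≈-trans (≈-intro eq) (≡⇒≈ (+-comm m n′)))))

  ⊖-cancelʳ : ∀ {m m′ n} → m < M → m′ < M → n ≤ M → m ⊖ n ≡ m′ ⊖ n → m ≡ m′
  ⊖-cancelʳ {m} {m′} {n} m<M m′<M n≤M eq = ≈⇒≡ m<M m′<M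
    (≈-trans (≈-sym ([m⊖n]+n≈m m n≤M)) (≈-trans (≡⇒≈ (cong (_+ n) eq)) ([m⊖n]+n≈m m′ n≤M)))

  ⊖-cancelˡ : ∀ {m n n′} → n < M → n′ < M → m ⊖ n ≡ m ⊖ n′ → n ≡ n′
  ⊖-cancelˡ {m} {n} {n′} n<M n′<M eq = ≈⇒≡ n<M n′<M (+-cancelʳ-≈ (m ⊖ n) (begin
    n + (m ⊖ n)   ≡⟨ +-comm n (m ⊖ n) ⟩
    m ⊖ n + n     ≈⟨ [m⊖n]+n≈m m (<⇒≤ n<M) ⟩
    m             ≈⟨ [m⊖n]+n≈m m (<⇒≤ n′<M) ⟨
    m ⊖ n′ + n′   ≡⟨ cong (_+ n′) eq ⟨
    m ⊖ n + n′    ≡⟨ +-comm (m ⊖ n) n′ ⟩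
    n′ + (m ⊖ n)  ∎))
    where open import Relation.Binary.Reasoning.Setoid ≈-setoid

-- For odd N, with h the inverse of 2 modulo N: the t-th factor matches a with t − a (mod N),
-- and the unique fixed point t/2 of that reflection with N.
module RoundRobin (N h : ℕ) .{{_ : NonZero N}} (h+h≡1+N : h + h ≡ suc N) where

  open Modular N

  half : ℕ → ℕ
  half t = (t * h) % N

  roundRobin : ℕ → ℕ → ℕ
  roundRobin t a with a <? N | t ⊖ a ≟ a
  ... | yes _ | yes _ = N
  ... | yes _ | no _ = t ⊖ a
  ... | no _  | _ = half t

  roundRobin-fixed : ∀ {t a} → a < N → t ⊖ a ≡ a → roundRobin t a ≡ N
  roundRobin-fixed {t} {a} a<N fixed with a <? N | t ⊖ a ≟ a
  ... | yes _ | yes _ = refl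
  ... | yes _ | no moved = ⊥-elim (moved fixed)
  ... | no a≮N | _ = ⊥-elim (a≮N a<N)

  roundRobin-moved : ∀ {t a} → a < N → t ⊖ a ≢ a → roundRobin t a ≡ t ⊖ a
  roundRobin-moved {t} {a} a<N moved with a <? N | t ⊖ a ≟ a
  ... | yes _ | yes fixed = ⊥-elim (moved fixed)
  ... | yes _ | no _ = refl
  ... | no a≮N | _ = ⊥-elim (a≮N a<N)

  roundRobin-N : ∀ {t} → roundRobin t N ≡ half t
  roundRobin-N {t} with N <? N
  ... | yes N<N = ⊥-elim (<-irrefl refl N<N)
  ... | no _ = refl

  half-< : ∀ t → half t < N
  half-< t = m%n<n (t * h) N

  half-+ : ∀ t → half t + half t ≈ t
  half-+ t = ≈-trans (+-≈ (%-≈ (t * h)) (%-≈ (t * h))) (≈-trans (≡⇒≈ double) (+-*-≈ t t))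
    where
    double : t * h + t * h ≡ t + t * N
    double = trans (sym (*-distribˡ-+ t h h)) (trans (cong (t *_) h+h≡1+N) (*-suc t N))

  half-unique : ∀ {a t} → a < N → a + a ≈ t → half t ≡ a
  half-unique {a} {t} a<N a+a≈t = ≈⇒≡ (half-< t) a<N (≈-trans (%-≈ (t * h))
    (≈-trans (*-≈ (≈-sym a+a≈t) (≈-refl {h})) (≈-trans (≡⇒≈ double) (+-*-≈ a a))))
    where
    double : (a + a) * h ≡ a + a * N
    double = trans (*-distribʳ-+ h a a)
                   (trans (sym (*-distribˡ-+ a h h)) (trans (cong (a *_) h+h≡1+N) (*-suc a N)))

  half-injective : ∀ {t t′} → t < N → t′ < N → half t ≡ half t′ → t ≡ t′
  half-injective {t} {t′} t<N t′<N eq =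
    ≈⇒≡ t<N t′<N (≈-trans (≈-sym (half-+ t)) (≈-trans (≡⇒≈ (cong₂ _+_ eq eq)) (half-+ t′)))

  t⊖half≡half : ∀ t → t ⊖ half t ≡ half t
  t⊖half≡half t = ≈⇒≡ (⊖-< t (half t)) (half-< t)
    (+-cancelʳ-≈ (half t) (≈-trans ([m⊖n]+n≈m t (<⇒≤ (half-< t))) (≈-sym (half-+ t))))

  fixed⇒half : ∀ {t a} → a < N → t ⊖ a ≡ a → half t ≡ a
  fixed⇒half {t} {a} a<N fixed =
    half-unique a<N (≈-trans (≡⇒≈ (cong (_+ a) (sym fixed))) ([m⊖n]+n≈m t (<⇒≤ a<N)))

  roundRobin-≤ : ∀ t a → roundRobin t a ≤ N
  roundRobin-≤ t a with a <? N | t ⊖ a ≟ a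
  ... | yes _ | yes _ = ≤-refl
  ... | yes _ | no _ = <⇒≤ (⊖-< t a)
  ... | no _  | _ = <⇒≤ (half-< t)

  roundRobin-involutive : ∀ {t a} → a ≤ N → roundRobin t (roundRobin t a) ≡ a
  roundRobin-involutive {t} {a} a≤N with m≤n⇒m<n∨m≡n a≤N
  ... | inj₂ refl = trans (cong (roundRobin t) roundRobin-N) (roundRobin-fixed (half-< t) (t⊖half≡half t))
  ... | inj₁ a<N with toSum (t ⊖ a ≟ a)
  ...   | inj₁ fixed =
    trans (cong (roundRobin t) (roundRobin-fixed a<N fixed)) (trans roundRobin-N (fixed⇒half a<N fixed))
  ...   | inj₂ moved = begin
    roundRobin t (roundRobin t a)  ≡⟨ cong (roundRobin t) (roundRobin-moved a<N moved) ⟩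
    roundRobin t (t ⊖ a)           ≡⟨ roundRobin-moved (⊖-< t a) (λ eq → moved (trans (sym eq) (m⊖[m⊖n]≡n a<N))) ⟩
    t ⊖ (t ⊖ a)                    ≡⟨ m⊖[m⊖n]≡n a<N ⟩
    a                              ∎
    where open ≡-Reasoning

  roundRobin-≢ : ∀ {t a} → a ≤ N → roundRobin t a ≢ a
  roundRobin-≢ {t} {a} a≤N with m≤n⇒m<n∨m≡n a≤N
  ... | inj₂ refl = λ eq → <-irrefl (trans (sym roundRobin-N) eq) (half-< t)
  ... | inj₁ a<N with toSum (t ⊖ a ≟ a)
  ...   | inj₁ fixed = λ eq → <-irrefl (trans (sym eq) (roundRobin-fixed a<N fixed)) a<N
  ...   | inj₂ moved = λ eq → moved (trans (sym (roundRobin-moved a<N moved)) eq)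

  roundRobin-covers : ∀ {a b} → a ≤ N → b ≤ N → a ≢ b → Σ ℕ λ t → t < N × roundRobin t a ≡ b
  roundRobin-covers {a} {b} a≤N b≤N a≢b with m≤n⇒m<n∨m≡n a≤N | m≤n⇒m<n∨m≡n b≤N
  ... | inj₂ refl | inj₂ refl = ⊥-elim (a≢b refl)
  ... | inj₂ refl | inj₁ b<N =
    b ⊕ b , ⊕-< b b , trans roundRobin-N (half-unique b<N (≈-sym (%-≈ (b + b))))
  ... | inj₁ a<N | inj₂ refl =
    a ⊕ a , ⊕-< a a , roundRobin-fixed a<N ([m⊕n]⊖n≡m a<N (<⇒≤ a<N))
  ... | inj₁ a<N | inj₁ b<N =
    b ⊕ a , ⊕-< b a , trans (roundRobin-moved a<N (λ eq → a≢b (trans (sym eq) b⊕a⊖a≡b))) b⊕a⊖a≡b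
    where
    b⊕a⊖a≡b : (b ⊕ a) ⊖ a ≡ b
    b⊕a⊖a≡b = [m⊕n]⊖n≡m b<N (<⇒≤ a<N)

  roundRobin-disjoint : ∀ {t t′ a} → t < N → t′ < N → a ≤ N →
    roundRobin t a ≡ roundRobin t′ a → t ≡ t′
  roundRobin-disjoint {t} {t′} {a} t<N t′<N a≤N eq with m≤n⇒m<n∨m≡n a≤N
  ... | inj₂ refl = half-injective t<N t′<N (trans (sym roundRobin-N) (trans eq roundRobin-N))
  ... | inj₁ a<N with toSum (t ⊖ a ≟ a) | toSum (t′ ⊖ a ≟ a)
  ...   | inj₁ fixed | inj₁ fixed′ = ⊖-cancelʳ t<N t′<N a≤N (trans fixed (sym fixed′))
  ...   | inj₁ fixed | inj₂ moved′ =
    ⊥-elim (<-irrefl (trans (sym (roundRobin-moved a<N moved′)) (trans (sym eq) (roundRobin-fixed a<N fixed)))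
                     (⊖-< t′ a))
  ...   | inj₂ moved | inj₁ fixed′ =
    ⊥-elim (<-irrefl (trans (sym (roundRobin-moved a<N moved)) (trans eq (roundRobin-fixed a<N fixed′)))
                     (⊖-< t a))
  ...   | inj₂ moved | inj₂ moved′ =
    ⊖-cancelʳ t<N t′<N a≤N
      (trans (sym (roundRobin-moved a<N moved)) (trans eq (roundRobin-moved a<N moved′)))

-- Sign sequences and zero-sum sequences

sign : ℕ → ℤ
sign 0 = 1ℤ
sign 1 = -1ℤ
sign (suc (suc m)) = sign m

sign-+ : ∀ a b → sign (a + b) ≡ sign a *ℤ sign b
sign-+ zero b = sym (ℤP.*-identityˡ (sign b))
sign-+ 1 zero = refl
sign-+ 1 1 = refl
sign-+ 1 (suc (suc b)) = sign-+ 1 b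
sign-+ (suc (suc a)) b = sign-+ a b

sign-*-sign : ∀ a → sign a *ℤ sign a ≡ 1ℤ
sign-*-sign zero = refl
sign-*-sign 1 = refl
sign-*-sign (suc (suc a)) = sign-*-sign a

∣sign∣≡1 : ∀ a → ∣ sign a ∣ ≡ 1
∣sign∣≡1 zero = refl
∣sign∣≡1 1 = refl
∣sign∣≡1 (suc (suc a)) = ∣sign∣≡1 a

double : ℕ → ℕ
double zero = zero
double (suc m) = suc (suc (double m))

double≡m+m : ∀ m → double m ≡ m + m
double≡m+m zero = refl
double≡m+m (suc m) = cong suc (trans (cong suc (double≡m+m m)) (sym (+-suc m m)))

sign-double : ∀ m → sign (double m) ≡ 1ℤ
sign-double zero = refl
sign-double (suc m) = sign-double m

sum-sign : ∀ m → sum< (double m) sign ≡ 0ℤ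
sum-sign zero = refl
sum-sign (suc m) = cong (λ s → 1ℤ +ℤ (-1ℤ +ℤ s)) (sum-sign m)

stutter : (ℕ → ℤ) → ℕ → ℤ
stutter g 0 = g 0
stutter g 1 = g 0
stutter g (suc (suc b)) = stutter (g ∘ suc) b

sum-stutter : ∀ m g → sum< (double m) (stutter g) ≡ sum< m g +ℤ sum< m g
sum-stutter zero g = refl
sum-stutter (suc m) g =
  trans (cong (λ s → g 0 +ℤ (g 0 +ℤ s)) (sum-stutter m (g ∘ suc))) (regroup (g 0) (sum< m (g ∘ suc)))
  where
  regroup : ∀ a s → a +ℤ (a +ℤ (s +ℤ s)) ≡ (a +ℤ s) +ℤ (a +ℤ s)
  regroup a s = begin
    a +ℤ (a +ℤ (s +ℤ s))  ≡⟨ cong (a +ℤ_) (ℤP.+-assoc a s s) ⟨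
    a +ℤ ((a +ℤ s) +ℤ s)  ≡⟨ cong (a +ℤ_) (ℤP.+-comm (a +ℤ s) s) ⟩
    a +ℤ (s +ℤ (a +ℤ s))  ≡⟨ ℤP.+-assoc a s (a +ℤ s) ⟨
    (a +ℤ s) +ℤ (a +ℤ s)  ∎
    where open ≡-Reasoning

sum-sign-*-stutter : ∀ m g → sum< (double m) (λ c → sign c *ℤ stutter g c) ≡ 0ℤ
sum-sign-*-stutter zero g = refl
sum-sign-*-stutter (suc m) g =
  trans (cong (λ s → 1ℤ *ℤ g 0 +ℤ (-1ℤ *ℤ g 0 +ℤ s)) (sum-sign-*-stutter m (g ∘ suc))) (cancel (g 0))
  where
  cancel : ∀ z → 1ℤ *ℤ z +ℤ (-1ℤ *ℤ z +ℤ 0ℤ) ≡ 0ℤ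
  cancel z = trans (cong₂ _+ℤ_ (ℤP.*-identityˡ z) (trans (ℤP.+-identityʳ _) (ℤP.-1*i≡-i z)))
                   (ℤP.+-inverseʳ z)

stutter-preserves : ∀ (P : ℤ → Set) g → (∀ i → P (g i)) → ∀ b → P (stutter g b)
stutter-preserves P g Pg zero = Pg 0
stutter-preserves P g Pg 1 = Pg 0
stutter-preserves P g Pg (suc (suc b)) = stutter-preserves P (g ∘ suc) (Pg ∘ suc) b

balanced : ℕ → ℕ → ℤ
balanced 0 0 = 1ℤ
balanced 0 (suc _) = -1ℤ
balanced 1 0 = 1ℤ +ℤ 1ℤ
balanced 1 (suc _) = -1ℤ
balanced (suc (suc m)) 0 = 1ℤ
balanced (suc (suc m)) 1 = -1ℤ
balanced (suc (suc m)) (suc (suc j)) = balanced m j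

sum-balanced : ∀ m → sum< (suc (suc m)) (balanced m) ≡ 0ℤ
sum-balanced 0 = refl
sum-balanced 1 = refl
sum-balanced (suc (suc m)) = cong (λ s → 1ℤ +ℤ (-1ℤ +ℤ s)) (sum-balanced m)

balanced-valid : ∀ m j → ValidWeight 3 (balanced m j)
balanced-valid 0 0 = (λ ()) , s≤s z<s
balanced-valid 0 (suc _) = (λ ()) , s≤s z<s
balanced-valid 1 0 = (λ ()) , s≤s (s≤s z<s)
balanced-valid 1 (suc _) = (λ ()) , s≤s z<s
balanced-valid (suc (suc m)) 0 = (λ ()) , s≤s z<s
balanced-valid (suc (suc m)) 1 = (λ ()) , s≤s z<s
balanced-valid (suc (suc m)) (suc (suc j)) = balanced-valid m j

valid-sign-* : ∀ {k} a {z} → ValidWeight k z → ValidWeight k (sign a *ℤ z)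
valid-sign-* {k} a {z} (z≢0 , ∣z∣<k) =
  (λ eq → z≢0 (ℤP.∣i∣≡0⇒i≡0 (trans (sym ∣sign*z∣≡∣z∣) (cong ∣_∣ eq)))) ,
  subst (_< k) (sym ∣sign*z∣≡∣z∣) ∣z∣<k
  where
  ∣sign*z∣≡∣z∣ : ∣ sign a *ℤ z ∣ ≡ ∣ z ∣
  ∣sign*z∣≡∣z∣ = trans (ℤP.abs-* (sign a) z) (trans (cong (_* ∣ z ∣) (∣sign∣≡1 a)) (+-identityʳ ∣ z ∣))

valid-neg : ∀ {k z} → ValidWeight k z → ValidWeight k (- z)
valid-neg {k} {z} (z≢0 , ∣z∣<k) =
  (λ eq → z≢0 (trans (sym (ℤP.neg-involutive z)) (cong -_ eq))) ,
  subst (_< k) (sym (ℤP.∣-i∣≡∣i∣ z)) ∣z∣<k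

sign-*-double : ∀ q m → sign (q * double m) ≡ 1ℤ
sign-*-double q m = begin
  sign (q * double m)          ≡⟨ cong (λ d → sign (q * d)) (double≡m+m m) ⟩
  sign (q * (m + m))           ≡⟨ cong sign (*-distribˡ-+ q m m) ⟩
  sign (q * m + q * m)         ≡⟨ sign-+ (q * m) (q * m) ⟩
  sign (q * m) *ℤ sign (q * m) ≡⟨ sign-*-sign (q * m) ⟩
  1ℤ                           ∎
  where open ≡-Reasoning

-- The weighted 1-factorization for v ≡ 3 (mod 4)

-- The vertices 0, …, 2K − 1 form the halves a < K and K + b; the factors x < K are the cross matchings
-- a ↦ K + (a + x mod K), the factors K + t (t < N) the round-robin matchings on both halves.
module ConcreteFactorization (i : ℕ) where

  h N K n : ℕ
  h = suc (suc i)
  N = suc (suc (suc (double i)))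
  K = double h
  n = K + N

  open Modular K
  open RoundRobin N h (sym (double≡m+m h))
    using (roundRobin; roundRobin-≤; roundRobin-involutive; roundRobin-≢; roundRobin-covers; roundRobin-disjoint)

  ρ β : ℕ → ℤ
  ρ = stutter (balanced i)
  β = balanced (suc (double i))

  mate : ℕ → ℕ → ℕ
  mate x y with x <? K | y <? K
  ... | yes _ | yes _ = K + (y ⊕ x)
  ... | yes _ | no _  = (y ∸ K) ⊖ x
  ... | no _  | yes _ = roundRobin (x ∸ K) y
  ... | no _  | no _  = K + roundRobin (x ∸ K) (y ∸ K)

  weight : ℕ → ℕ → ℤ
  weight x y with x <? K | y <? K
  ... | yes _ | yes _ = sign y *ℤ ρ (y ⊕ x)
  ... | yes _ | no _  = sign ((y ∸ K) ⊖ x) *ℤ ρ (y ∸ K)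
  ... | no _  | yes _ = β (x ∸ K)
  ... | no _  | no _  = - β (x ∸ K)

  K+b≮K : ∀ b → ¬ K + b < K
  K+b≮K b K+b<K = <-irrefl refl (≤-<-trans (m≤m+n K b) K+b<K)

  K+b∸K≡b : ∀ b → K + b ∸ K ≡ b
  K+b∸K≡b = m+n∸m≡n K

  mate-cross-low : ∀ {x a} → x < K → a < K → mate x a ≡ K + (a ⊕ x)
  mate-cross-low {x} {a} x<K a<K with x <? K | a <? K
  ... | yes _ | yes _ = refl
  ... | no x≮K | _ = ⊥-elim (x≮K x<K)
  ... | yes _ | no a≮K = ⊥-elim (a≮K a<K)

  mate-cross-high : ∀ {x b} → x < K → mate x (K + b) ≡ b ⊖ x
  mate-cross-high {x} {b} x<K with x <? K | K + b <? K
  ... | yes _ | no _ = cong (_⊖ x) (K+b∸K≡b b)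
  ... | no x≮K | _ = ⊥-elim (x≮K x<K)
  ... | yes _ | yes K+b<K = ⊥-elim (K+b≮K b K+b<K)

  mate-rr-low : ∀ {t a} → a < K → mate (K + t) a ≡ roundRobin t a
  mate-rr-low {t} {a} a<K with K + t <? K | a <? K
  ... | no _ | yes _ = cong (λ t′ → roundRobin t′ a) (K+b∸K≡b t)
  ... | yes K+t<K | _ = ⊥-elim (K+b≮K t K+t<K)
  ... | no _ | no a≮K = ⊥-elim (a≮K a<K)

  mate-rr-high : ∀ {t b} → mate (K + t) (K + b) ≡ K + roundRobin t b
  mate-rr-high {t} {b} with K + t <? K | K + b <? K
  ... | no _ | no _ = cong₂ (λ t′ b′ → K + roundRobin t′ b′) (K+b∸K≡b t) (K+b∸K≡b b)
  ... | yes K+t<K | _ = ⊥-elim (K+b≮K t K+t<K)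
  ... | no _ | yes K+b<K = ⊥-elim (K+b≮K b K+b<K)

  weight-cross-low : ∀ {x a} → x < K → a < K → weight x a ≡ sign a *ℤ ρ (a ⊕ x)
  weight-cross-low {x} {a} x<K a<K with x <? K | a <? K
  ... | yes _ | yes _ = refl
  ... | no x≮K | _ = ⊥-elim (x≮K x<K)
  ... | yes _ | no a≮K = ⊥-elim (a≮K a<K)

  weight-cross-high : ∀ {x b} → x < K → weight x (K + b) ≡ sign (b ⊖ x) *ℤ ρ b
  weight-cross-high {x} {b} x<K with x <? K | K + b <? K
  ... | yes _ | no _ = cong (λ b′ → sign (b′ ⊖ x) *ℤ ρ b′) (K+b∸K≡b b)
  ... | no x≮K | _ = ⊥-elim (x≮K x<K)
  ... | yes _ | yes K+b<K = ⊥-elim (K+b≮K b K+b<K)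

  weight-rr-low : ∀ {t a} → a < K → weight (K + t) a ≡ β t
  weight-rr-low {t} {a} a<K with K + t <? K | a <? K
  ... | no _ | yes _ = cong β (K+b∸K≡b t)
  ... | yes K+t<K | _ = ⊥-elim (K+b≮K t K+t<K)
  ... | no _ | no a≮K = ⊥-elim (a≮K a<K)

  weight-rr-high : ∀ {t b} → weight (K + t) (K + b) ≡ - β t
  weight-rr-high {t} {b} with K + t <? K | K + b <? K
  ... | no _ | no _ = cong (λ t′ → - β t′) (K+b∸K≡b t)
  ... | yes K+t<K | _ = ⊥-elim (K+b≮K t K+t<K)
  ... | no _ | yes K+b<K = ⊥-elim (K+b≮K b K+b<K)

  sign-% : ∀ m → sign (m % K) ≡ sign m
  sign-% m = sym (begin
    sign m                                   ≡⟨ cong sign (m≡m%n+[m/n]*n m K) ⟩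
    sign (m % K + (m / K) * K)               ≡⟨ sign-+ (m % K) ((m / K) * K) ⟩
    sign (m % K) *ℤ sign ((m / K) * K)       ≡⟨ cong (sign (m % K) *ℤ_) (sign-*-double (m / K) h) ⟩
    sign (m % K) *ℤ 1ℤ                       ≡⟨ ℤP.*-identityʳ _ ⟩
    sign (m % K)                             ∎)
    where open ≡-Reasoning

  sign-⊕ : ∀ a b → sign (a ⊕ b) ≡ sign a *ℤ sign b
  sign-⊕ a b = trans (sign-% (a + b)) (sign-+ a b)

  sign-⊖ : ∀ b {s} → s ≤ K → sign (b ⊖ s) ≡ sign b *ℤ sign s
  sign-⊖ b {s} s≤K = trans (sign-% (b + (K ∸ s))) (trans (sign-+ b (K ∸ s)) (cong (sign b *ℤ_) sign-K∸s))
    where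
    sign-K∸s : sign (K ∸ s) ≡ sign s
    sign-K∸s = begin
      sign (K ∸ s)                               ≡⟨ ℤP.*-identityʳ _ ⟨
      sign (K ∸ s) *ℤ 1ℤ                         ≡⟨ cong (sign (K ∸ s) *ℤ_) (sign-*-sign s) ⟨
      sign (K ∸ s) *ℤ (sign s *ℤ sign s)         ≡⟨ ℤP.*-assoc (sign (K ∸ s)) (sign s) (sign s) ⟨
      (sign (K ∸ s) *ℤ sign s) *ℤ sign s         ≡⟨ cong (_*ℤ sign s) (sym (sign-+ (K ∸ s) s)) ⟩
      sign (K ∸ s + s) *ℤ sign s                 ≡⟨ cong (λ m → sign m *ℤ sign s) (m∸n+n≡m s≤K) ⟩
      sign K *ℤ sign s                           ≡⟨ cong (_*ℤ sign s) (sign-double h) ⟩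
      1ℤ *ℤ sign s                               ≡⟨ ℤP.*-identityˡ (sign s) ⟩
      sign s                                     ∎
      where open ≡-Reasoning

  sum-ρ : sum< K ρ ≡ 0ℤ
  sum-ρ = trans (sum-stutter h (balanced i)) (cong (λ s → s +ℤ s) (sum-balanced i))

  sum-sign-*-ρ : sum< K (λ c → sign c *ℤ ρ c) ≡ 0ℤ
  sum-sign-*-ρ = sum-sign-*-stutter h (balanced i)

  sum-β : sum< N β ≡ 0ℤ
  sum-β = sum-balanced (suc (double i))

  ρ-valid : ∀ c → ValidWeight 3 (ρ c)
  ρ-valid = stutter-preserves (ValidWeight 3) (balanced i) (balanced-valid i)

  β-valid : ∀ t → ValidWeight 3 (β t)
  β-valid = balanced-valid (suc (double i))

  weight-valid : ∀ x y → ValidWeight 3 (weight x y)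
  weight-valid x y with x <? K | y <? K
  ... | yes _ | yes _ = valid-sign-* y (ρ-valid (y ⊕ x))
  ... | yes _ | no _  = valid-sign-* ((y ∸ K) ⊖ x) (ρ-valid (y ∸ K))
  ... | no _  | yes _ = β-valid (x ∸ K)
  ... | no _  | no _  = valid-neg (β-valid (x ∸ K))

  <K⇒<n : ∀ {u} → u < K → u < n
  <K⇒<n u<K = <-≤-trans u<K (m≤m+n K N)

  <K⇒<K+ : ∀ b {u} → u < K → u < K + b
  <K⇒<K+ b u<K = <-≤-trans u<K (m≤m+n K b)

  data Vertex : ℕ → Set where
    lowerHalf : ∀ {a} → a < K → Vertex a
    upperHalf : ∀ {b} → b < K → Vertex (K + b)

  vertex : ∀ {y} → y ≤ n → Vertex y
  vertex {y} y≤n with splitAt K y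
  ... | low y<K = lowerHalf y<K
  ... | high b refl = upperHalf (s≤s (+-cancelˡ-≤ K b N y≤n))

  data Factor : ℕ → Set where
    crossFactor      : ∀ {x} → x < K → Factor x
    roundRobinFactor : ∀ {t} → t < N → Factor (K + t)

  factor : ∀ {x} → x < n → Factor x
  factor {x} x<n with splitAt K x
  ... | low x<K = crossFactor x<K
  ... | high t refl = roundRobinFactor (+-cancelˡ-< K t N x<n)

  mate-≤ : ∀ {x y} → x < n → y ≤ n → mate x y ≤ n
  mate-≤ x<n y≤n with factor x<n | vertex y≤n
  ... | crossFactor x<K | lowerHalf {a} a<K =
    subst (_≤ n) (sym (mate-cross-low x<K a<K)) (+-monoʳ-≤ K (s≤s⁻¹ (⊕-< a _)))
  ... | crossFactor {x} x<K | upperHalf {b} _ =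
    subst (_≤ n) (sym (mate-cross-high x<K)) (<⇒≤ (<K⇒<n (⊖-< b x)))
  ... | roundRobinFactor {t} _ | lowerHalf {a} a<K =
    subst (_≤ n) (sym (mate-rr-low a<K)) (≤-trans (roundRobin-≤ t a) (m≤n+m N K))
  ... | roundRobinFactor {t} _ | upperHalf {b} _ =
    subst (_≤ n) (sym mate-rr-high) (+-monoʳ-≤ K (roundRobin-≤ t b))

  mate-involutive : ∀ {x y} → x < n → y ≤ n → mate x (mate x y) ≡ y
  mate-involutive x<n y≤n with factor x<n | vertex y≤n
  ... | crossFactor {x} x<K | lowerHalf a<K =
    trans (cong (mate x) (mate-cross-low x<K a<K)) (trans (mate-cross-high x<K) ([m⊕n]⊖n≡m a<K (<⇒≤ x<K)))
  ... | crossFactor {x} x<K | upperHalf {b} b<K =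
    trans (cong (mate x) (mate-cross-high x<K))
          (trans (mate-cross-low x<K (⊖-< b x)) (cong (K +_) ([m⊖n]⊕n≡m b<K (<⇒≤ x<K))))
  ... | roundRobinFactor {t} _ | lowerHalf {a} a<K =
    trans (cong (mate (K + t)) (mate-rr-low a<K))
          (trans (mate-rr-low (s≤s (roundRobin-≤ t a))) (roundRobin-involutive (s≤s⁻¹ a<K)))
  ... | roundRobinFactor {t} _ | upperHalf b<K =
    trans (cong (mate (K + t)) mate-rr-high) (trans mate-rr-high (cong (K +_) (roundRobin-involutive (s≤s⁻¹ b<K))))

  mate-≢ : ∀ {x y} → x < n → y ≤ n → mate x y ≢ y
  mate-≢ x<n y≤n with factor x<n | vertex y≤n
  ... | crossFactor x<K | lowerHalf a<K = λ eq → <-irrefl (trans (sym eq) (mate-cross-low x<K a<K)) (<K⇒<K+ _ a<K)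
  ... | crossFactor {x} x<K | upperHalf {b} _ =
    λ eq → <-irrefl (trans (sym (mate-cross-high x<K)) eq) (<K⇒<K+ b (⊖-< b x))
  ... | roundRobinFactor _ | lowerHalf a<K = λ eq → roundRobin-≢ (s≤s⁻¹ a<K) (trans (sym (mate-rr-low a<K)) eq)
  ... | roundRobinFactor _ | upperHalf b<K =
    λ eq → roundRobin-≢ (s≤s⁻¹ b<K) (+-cancelˡ-≡ K _ _ (trans (sym mate-rr-high) eq))

  mate-covers : ∀ {y y′} → y ≤ n → y′ ≤ n → y ≢ y′ → Σ ℕ λ x → x < n × mate x y ≡ y′
  mate-covers y≤n y′≤n y≢y′ with vertex y≤n | vertex y′≤n
  ... | lowerHalf a<K | lowerHalf a′<K =
    let t , t<N , eq = roundRobin-covers (s≤s⁻¹ a<K) (s≤s⁻¹ a′<K) y≢y′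
    in K + t , +-monoʳ-< K t<N , trans (mate-rr-low a<K) eq
  ... | upperHalf b<K | upperHalf b′<K =
    let t , t<N , eq = roundRobin-covers (s≤s⁻¹ b<K) (s≤s⁻¹ b′<K) (y≢y′ ∘ cong (K +_))
    in K + t , +-monoʳ-< K t<N , trans mate-rr-high (cong (K +_) eq)
  ... | lowerHalf {a} a<K | upperHalf {b} b<K =
    b ⊖ a , <K⇒<n (⊖-< b a) , trans (mate-cross-low (⊖-< b a) a<K) (cong (K +_) (m⊕[n⊖m]≡n (<⇒≤ a<K) b<K))
  ... | upperHalf {b} _ | lowerHalf {a} a<K =
    b ⊖ a , <K⇒<n (⊖-< b a) , trans (mate-cross-high (⊖-< b a)) (m⊖[m⊖n]≡n {b} a<K)

  mate-disjoint : ∀ {x x′ y} → x < n → x′ < n → y ≤ n → mate x y ≡ mate x′ y → x ≡ x′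
  mate-disjoint x<n x′<n y≤n eq with factor x<n | factor x′<n | vertex y≤n
  ... | crossFactor x<K | crossFactor x′<K | lowerHalf {a} a<K = ⊕-cancelˡ {a} x<K x′<K
    (+-cancelˡ-≡ K _ _ (trans (sym (mate-cross-low x<K a<K)) (trans eq (mate-cross-low x′<K a<K))))
  ... | crossFactor x<K | crossFactor x′<K | upperHalf {b} _ = ⊖-cancelˡ {b} x<K x′<K
    (trans (sym (mate-cross-high x<K)) (trans eq (mate-cross-high x′<K)))
  ... | crossFactor x<K | roundRobinFactor {t} _ | lowerHalf {a} a<K = ⊥-elim (<-irrefl
    (trans (sym (mate-rr-low a<K)) (trans (sym eq) (mate-cross-low x<K a<K))) (<K⇒<K+ _ (s≤s (roundRobin-≤ t a))))
  ... | crossFactor {x} x<K | roundRobinFactor _ | upperHalf {b} _ = ⊥-elim (<-irrefl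
    (trans (sym (mate-cross-high x<K)) (trans eq mate-rr-high)) (<K⇒<K+ _ (⊖-< b x)))
  ... | roundRobinFactor {t} _ | crossFactor x′<K | lowerHalf {a} a<K = ⊥-elim (<-irrefl
    (trans (sym (mate-rr-low a<K)) (trans eq (mate-cross-low x′<K a<K))) (<K⇒<K+ _ (s≤s (roundRobin-≤ t a))))
  ... | roundRobinFactor _ | crossFactor {x′} x′<K | upperHalf {b} _ = ⊥-elim (<-irrefl
    (trans (sym (mate-cross-high x′<K)) (trans (sym eq) mate-rr-high)) (<K⇒<K+ _ (⊖-< b x′)))
  ... | roundRobinFactor t<N | roundRobinFactor t′<N | lowerHalf a<K = cong (K +_) (roundRobin-disjoint t<N t′<N
    (s≤s⁻¹ a<K) (trans (sym (mate-rr-low a<K)) (trans eq (mate-rr-low a<K))))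
  ... | roundRobinFactor t<N | roundRobinFactor t′<N | upperHalf b<K = cong (K +_) (roundRobin-disjoint t<N t′<N
    (s≤s⁻¹ b<K) (+-cancelˡ-≡ K _ _ (trans (sym mate-rr-high) (trans eq mate-rr-high))))

  weight-sym : ∀ {x y} → x < n → y ≤ n → weight x (mate x y) ≡ weight x y
  weight-sym x<n y≤n with factor x<n | vertex y≤n
  ... | crossFactor {x} x<K | lowerHalf {a} a<K = begin
    weight x (mate x a)                  ≡⟨ cong (weight x) (mate-cross-low x<K a<K) ⟩
    weight x (K + (a ⊕ x))               ≡⟨ weight-cross-high x<K ⟩
    sign ((a ⊕ x) ⊖ x) *ℤ ρ (a ⊕ x)      ≡⟨ cong (λ c → sign c *ℤ ρ (a ⊕ x)) ([m⊕n]⊖n≡m a<K (<⇒≤ x<K)) ⟩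
    sign a *ℤ ρ (a ⊕ x)                  ≡⟨ weight-cross-low x<K a<K ⟨
    weight x a                           ∎
    where open ≡-Reasoning
  ... | crossFactor {x} x<K | upperHalf {b} b<K = begin
    weight x (mate x (K + b))            ≡⟨ cong (weight x) (mate-cross-high x<K) ⟩
    weight x (b ⊖ x)                     ≡⟨ weight-cross-low x<K (⊖-< b x) ⟩
    sign (b ⊖ x) *ℤ ρ ((b ⊖ x) ⊕ x)      ≡⟨ cong (λ c → sign (b ⊖ x) *ℤ ρ c) ([m⊖n]⊕n≡m b<K (<⇒≤ x<K)) ⟩
    sign (b ⊖ x) *ℤ ρ b                  ≡⟨ weight-cross-high x<K ⟨
    weight x (K + b)                     ∎
    where open ≡-Reasoning
  ... | roundRobinFactor {t} _ | lowerHalf {a} a<K =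
    trans (cong (weight (K + t)) (mate-rr-low a<K))
          (trans (weight-rr-low (s≤s (roundRobin-≤ t a))) (sym (weight-rr-low a<K)))
  ... | roundRobinFactor {t} _ | upperHalf _ =
    trans (cong (weight (K + t)) mate-rr-high) (trans weight-rr-high (sym weight-rr-high))

  weight-vertex : ∀ {y} → y ≤ n → sum< n (λ x → weight x y) ≡ 0ℤ
  weight-vertex {y} y≤n = trans (sum<-+ K N (λ x → weight x y)) (halves (vertex y≤n))
    where
    halves : ∀ {y} → Vertex y → sum< K (λ x → weight x y) +ℤ sum< N (λ t → weight (K + t) y) ≡ 0ℤ
    halves (lowerHalf {y} y<K) = cong₂ _+ℤ_ cross roundRobinPart
      where
      cross : sum< K (λ x → weight x y) ≡ 0ℤ
      cross = begin
        sum< K (λ x → weight x y)                  ≡⟨ sum<-cong K (λ x x<K → weight-cross-low x<K y<K) ⟩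
        sum< K (λ x → sign y *ℤ ρ ((y + x) % K))   ≡⟨ sum<-*ˡ K (sign y) (λ x → ρ ((y + x) % K)) ⟩
        sign y *ℤ sum< K (λ x → ρ ((y + x) % K))   ≡⟨ cong (sign y *ℤ_) (trans (sum<-rotate K y<K ρ) sum-ρ) ⟩
        sign y *ℤ 0ℤ                               ≡⟨ ℤP.*-zeroʳ (sign y) ⟩
        0ℤ                                         ∎
        where open ≡-Reasoning
      roundRobinPart : sum< N (λ t → weight (K + t) y) ≡ 0ℤ
      roundRobinPart = trans (sum<-cong N λ t _ → weight-rr-low {t} y<K) sum-β
    halves (upperHalf {b} _) = cong₂ _+ℤ_ cross roundRobinPart
      where
      cross : sum< K (λ x → weight x (K + b)) ≡ 0ℤ
      cross = begin
        sum< K (λ x → weight x (K + b))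
          ≡⟨ sum<-cong K (λ x x<K → trans (weight-cross-high {x} {b} x<K) (cong (_*ℤ ρ b) (sign-⊖ b (<⇒≤ x<K)))) ⟩
        sum< K (λ x → sign b *ℤ sign x *ℤ ρ b)         ≡⟨ sum<-cong K (λ x _ → ℤP.*-comm (sign b *ℤ sign x) (ρ b)) ⟩
        sum< K (λ x → ρ b *ℤ (sign b *ℤ sign x))       ≡⟨ sum<-*ˡ K (ρ b) (λ x → sign b *ℤ sign x) ⟩
        ρ b *ℤ sum< K (λ x → sign b *ℤ sign x)         ≡⟨ cong (ρ b *ℤ_) (sum<-*ˡ K (sign b) sign) ⟩
        ρ b *ℤ (sign b *ℤ sum< K sign)                 ≡⟨ cong (λ s → ρ b *ℤ (sign b *ℤ s)) (sum-sign h) ⟩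
        ρ b *ℤ (sign b *ℤ 0ℤ)                          ≡⟨ cong (ρ b *ℤ_) (ℤP.*-zeroʳ (sign b)) ⟩
        ρ b *ℤ 0ℤ                                      ≡⟨ ℤP.*-zeroʳ (ρ b) ⟩
        0ℤ                                             ∎
        where open ≡-Reasoning
      roundRobinPart : sum< N (λ t → weight (K + t) (K + b)) ≡ 0ℤ
      roundRobinPart = trans (sum<-cong N λ t _ → weight-rr-high {t} {b}) (trans (sum<-neg N β) (cong -_ sum-β))

  weight-factor : ∀ {x} → x < n → sum< (suc n) (λ y → when (y <? mate x y) (weight x y)) ≡ 0ℤ
  weight-factor {x} x<n =
    trans (cong (λ m → sum< m f) (sym (+-suc K N))) (trans (sum<-+ K K f) (halves (factor x<n)))
    where
    f = λ y → when (y <? mate x y) (weight x y)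
    halves : Factor x → sum< K f +ℤ sum< K (λ b → f (K + b)) ≡ 0ℤ
    halves (crossFactor x<K) = cong₂ _+ℤ_ lowerSum upperSum
      where
      g = λ c → sign c *ℤ ρ c
      rotated : ∀ a → a < K → f a ≡ sign x *ℤ g ((x + a) % K)
      rotated a a<K = begin
        f a                                    ≡⟨ when-yes (a <? mate x a) _ a<mate ⟩
        weight x a                             ≡⟨ weight-cross-low x<K a<K ⟩
        sign a *ℤ ρ ((a + x) % K)              ≡⟨ cong (λ c → sign a *ℤ ρ (c % K)) (+-comm a x) ⟩
        sign a *ℤ ρ (x ⊕ a)                    ≡⟨ cong (_*ℤ ρ (x ⊕ a)) sign-a ⟩
        sign x *ℤ sign (x ⊕ a) *ℤ ρ (x ⊕ a)    ≡⟨ ℤP.*-assoc (sign x) (sign (x ⊕ a)) (ρ (x ⊕ a)) ⟩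
        sign x *ℤ g (x ⊕ a)                    ∎
        where
        open ≡-Reasoning
        a<mate : a < mate x a
        a<mate = subst (a <_) (sym (mate-cross-low x<K a<K)) (<K⇒<K+ _ a<K)
        sign-a : sign a ≡ sign x *ℤ sign (x ⊕ a)
        sign-a = begin
          sign a                          ≡⟨ ℤP.*-identityˡ (sign a) ⟨
          1ℤ *ℤ sign a                    ≡⟨ cong (_*ℤ sign a) (sign-*-sign x) ⟨
          sign x *ℤ sign x *ℤ sign a      ≡⟨ ℤP.*-assoc (sign x) (sign x) (sign a) ⟩
          sign x *ℤ (sign x *ℤ sign a)    ≡⟨ cong (sign x *ℤ_) (sign-⊕ x a) ⟨
          sign x *ℤ sign (x ⊕ a)          ∎
      lowerSum : sum< K f ≡ 0ℤ
      lowerSum = begin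
        sum< K f                                       ≡⟨ sum<-cong K rotated ⟩
        sum< K (λ a → sign x *ℤ g ((x + a) % K))       ≡⟨ sum<-*ˡ K (sign x) (λ a → g ((x + a) % K)) ⟩
        sign x *ℤ sum< K (λ a → g ((x + a) % K))
          ≡⟨ cong (sign x *ℤ_) (trans (sum<-rotate K x<K g) sum-sign-*-ρ) ⟩
        sign x *ℤ 0ℤ                                   ≡⟨ ℤP.*-zeroʳ (sign x) ⟩
        0ℤ                                             ∎
        where open ≡-Reasoning
      upperSum : sum< K (λ b → f (K + b)) ≡ 0ℤ
      upperSum = sum<-zero K λ b _ → when-no (K + b <? mate x (K + b)) (weight x (K + b)) λ K+b<mate →
        <-asym K+b<mate (subst (_< K + b) (sym (mate-cross-high x<K)) (<K⇒<K+ b (⊖-< b x)))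
    halves (roundRobinFactor {t} _) = trans (sym (sum<-distrib K f (λ b → f (K + b)))) (sum<-zero K pairsCancel)
      where
      pairsCancel : ∀ a → a < K → f a +ℤ f (K + a) ≡ 0ℤ
      pairsCancel a a<K = begin
        f a +ℤ f (K + a)
          ≡⟨ cong₂ _+ℤ_ (cong (when (a <? mate (K + t) a)) (weight-rr-low a<K))
                        (cong (when (K + a <? mate (K + t) (K + a))) (weight-rr-high {t} {a})) ⟩
        when (a <? mate (K + t) a) (β t) +ℤ when (K + a <? mate (K + t) (K + a)) (- β t)
          ≡⟨ when-+-when-neg (a <? mate (K + t) a) (K + a <? mate (K + t) (K + a)) (β t)
               (λ a<mate → subst (K + a <_) (sym mate-rr-high)
                             (+-monoʳ-< K (subst (a <_) (mate-rr-low a<K) a<mate)))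
               (λ K+a<mate → subst (a <_) (sym (mate-rr-low a<K))
                               (+-cancelˡ-< K _ _ (subst (K + a <_) mate-rr-high K+a<mate))) ⟩
        0ℤ ∎
        where open ≡-Reasoning

  weightedOneFactorization : WeightedOneFactorization 3 n
  weightedOneFactorization = record
    { mate               = mate
    ; weight             = weight
    ; isOneFactorization = record
      { mate-≤ = mate-≤ ; mate-involutive = mate-involutive ; mate-≢ = mate-≢
      ; mate-covers = mate-covers ; mate-disjoint = mate-disjoint }
    ; weight-sym         = weight-sym
    ; weight-valid       = weight-valid
    ; weight-vertex      = weight-vertex
    ; weight-factor      = weight-factor
    }

≡3-mod-4⇒order : ∀ v → v % 4 ≡ 3 → 3 < v → Σ ℕ λ i → v ≡ ConcreteFactorization.n i
≡3-mod-4⇒order v v%4≡3 3<v with v / 4 | m≡m%n+[m/n]*n v 4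
... | zero | v≡ = ⊥-elim (<-irrefl (sym (trans v≡ (cong (_+ 0) v%4≡3))) 3<v)
... | suc i | v≡ = i , (begin
  v                                  ≡⟨ v≡ ⟩
  v % 4 + suc i * 4                  ≡⟨ cong (_+ suc i * 4) v%4≡3 ⟩
  3 + suc i * 4                      ≡⟨ arithmetic i ⟩
  (2 + i) + (2 + i) + (3 + (i + i))  ≡⟨ cong₂ (λ a b → a + (3 + b)) (double≡m+m (2 + i)) (double≡m+m i) ⟨
  double (2 + i) + (3 + double i)    ∎)
  where
  open ≡-Reasoning
  arithmetic : ∀ i → 3 + suc i * 4 ≡ (2 + i) + (2 + i) + (3 + (i + i))
  arithmetic = solve-∀

mainTheorem5 : ∀ (v : ℕ) → v % 4 ≡ 3 → 3 < v →
    ∀ (B : List (Triple v)) → IsSTS v B → HasZeroSumFlow 3 B →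
      Σ (List (Triple (2 * v + 1))) λ C →
        IsSTS (2 * v + 1) C × HasZeroSumFlow 3 C × EmbedsIn B C
mainTheorem5 v v%4≡3 3<v with ≡3-mod-4⇒order v v%4≡3 3<v
... | i , refl = Doubling.doubling (ConcreteFactorization.weightedOneFactorization i)
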